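{- Let $n\ge2$, let $T$ be a standard tableau of shape $[n-1,1]$ with second-row entry $j$, and for integers $k,m\ge0$ let $Q_T^{k,m}=\int_{x_1}^{x_j}t^k\prod_{i=1}^n(t-x_i)^m\,dt$. Then $Q_T^{k,m}\in\gamma_T{\bf QI}_m$ for all $k,m$.
   Context: $S_n$ acts on ${\bf R}=\mathbb{Q}[x_1,\dots,x_n]$ by $\sigma P(x_1,\dots,x_n)=P(x_{\sigma(1)},\dots,x_{\sigma(n)})$, extended linearly to $\mathbb{Q}S_n$. ${\bf QI}_m$ is the set of $P\in{\bf R}$ such that $(x_a-x_b)^{2m+1}$ divides $(1-(a,b))P$ for every transposition $(a,b)$. Tableaux are in French convention (first row at the bottom); a standard tableau of shape $[n-1,1]$ is a bijective filling with $1,\dots,n$ increasing along rows and up columns. For $U\subseteq\{1,\dots,n\}$, $[U]=\sum_{\sigma\in S_U}\sigma$, $[U]'=\sum_{\sigma\in S_U}\mathrm{sgn}(\sigma)\sigma$. $N(T)=\prod_i[C_i]'$, $P(T)=\prod_i[R_i]$ over columns $C_i$ and rows $R_i$ of $T$, and $\gamma_T=\frac{f_\lambda}{n!}N(T)P(T)$ with $f_\lambda=n-1$ the number of standard tableaux of shape $[n-1,1]$. -}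

module Defs where

open import Data.Nat as ℕ using (ℕ; zero; suc; _∸_; _!; _≤_; s≤s)
open import Data.Nat.Properties using (_!≢0)
open import Data.Integer using (+_)
open import Data.Rational as ℚ using (ℚ; 0ℚ; 1ℚ)
open import Data.Fin as Fin using (Fin; _≟_)
open import Data.List using (List; []; _∷_; map; concatMap; foldr; length; allFin; filter)
open import Data.List.Relation.Binary.Permutation.Propositional using (_↭_)
open import Data.List.Relation.Unary.Linked using (Linked)
open import Data.Product using (Σ; _×_; _,_; ∃)
open import Data.Empty using (⊥)
open import Relation.Nullary using (yes; no; ¬_)
open import Relation.Nullary.Decidable using (⌊_⌋)
open import Relation.Binary.PropositionalEquality using (_≡_)

-- Polynomials in ℚ[x₁,…,xₙ]  (variable xᵢ is  var (i-1) : Fin n)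
-- Syntax trees, identified up to equality of the polynomial functions
-- ℚⁿ → ℚ (over the infinite field ℚ this is equality in ℚ[x₁,…,xₙ]).

infixl 6 _⊕_ _⊖_
infixl 7 _⊗_ _•_

data Poly (n : ℕ) : Set where
  con  : ℚ → Poly n
  var  : Fin n → Poly n
  _⊕_  : Poly n → Poly n → Poly n
  _⊗_  : Poly n → Poly n → Poly n
  neg  : Poly n → Poly n

⟦_⟧ : ∀ {n} → Poly n → (Fin n → ℚ) → ℚ
⟦ con c ⟧ ρ = c
⟦ var i ⟧ ρ = ρ i
⟦ p ⊕ q ⟧ ρ = ⟦ p ⟧ ρ ℚ.+ ⟦ q ⟧ ρ
⟦ p ⊗ q ⟧ ρ = ⟦ p ⟧ ρ ℚ.* ⟦ q ⟧ ρ
⟦ neg p ⟧ ρ = ℚ.- ⟦ p ⟧ ρ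

infix 4 _≈_
_≈_ : ∀ {n} → Poly n → Poly n → Set
p ≈ q = ∀ ρ → ⟦ p ⟧ ρ ≡ ⟦ q ⟧ ρ

_⊖_ : ∀ {n} → Poly n → Poly n → Poly n
p ⊖ q = p ⊕ neg q

_•_ : ∀ {n} → ℚ → Poly n → Poly n
c • p = con c ⊗ p

_^_ : ∀ {n} → Poly n → ℕ → Poly n
p ^ zero  = con 1ℚ
p ^ suc k = p ⊗ (p ^ k)

infix 4 _∣_
_∣_ : ∀ {n} → Poly n → Poly n → Set
d ∣ p = Σ (Poly _) λ g → p ≈ d ⊗ g

Perm : ℕ → Set
Perm n = Fin n → Fin n

act : ∀ {n} → Perm n → Poly n → Poly n
act σ (con c) = con c
act σ (var i) = var (σ i)
act σ (p ⊕ q) = act σ p ⊕ act σ q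
act σ (p ⊗ q) = act σ p ⊗ act σ q
act σ (neg p) = neg (act σ p)

transp : ∀ {n} → Fin n → Fin n → Perm n
transp a b x with x ≟ a | x ≟ b
... | yes _ | _     = b
... | no _  | yes _ = a
... | no _  | no _  = x

inversions : ∀ {n} → Perm n → ℕ
inversions {n} σ =
  length (filter (λ ab → Fin._<?_ (σ (Data.Product.proj₂ ab)) (σ (Data.Product.proj₁ ab)))
                 (filter (λ ab → Fin._<?_ (Data.Product.proj₁ ab) (Data.Product.proj₂ ab))
                         (concatMap (λ a → map (λ b → a , b) (allFin n)) (allFin n))))

sgnℚ : ℕ → ℚ
sgnℚ zero          = 1ℚ
sgnℚ (suc zero)    = ℚ.- 1ℚ
sgnℚ (suc (suc k)) = sgnℚ k

sgn : ∀ {n} → Perm n → ℚ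
sgn σ = sgnℚ (inversions σ)

insertions : ∀ {A : Set} → A → List A → List (List A)
insertions x []       = (x ∷ []) ∷ []
insertions x (y ∷ ys) = (x ∷ y ∷ ys) ∷ map (y ∷_) (insertions x ys)

arrangements : ∀ {A : Set} → List A → List (List A)
arrangements []       = [] ∷ []
arrangements (x ∷ xs) = concatMap (insertions x) (arrangements xs)

fromArr : ∀ {n} → List (Fin n) → List (Fin n) → Perm n
fromArr []       _        x = x
fromArr (u ∷ us) []       x = x
fromArr (u ∷ us) (v ∷ vs) x with x ≟ u
... | yes _ = v
... | no _  = fromArr us vs x

-- the symmetric group S_U on the (duplicate-free) list U
S : ∀ {n} → List (Fin n) → List (Perm n)
S U = map (fromArr U) (arrangements U)

sumP : ∀ {n} → List (Poly n) → Poly n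
sumP = foldr _⊕_ (con 0ℚ)

[_]act : ∀ {n} → List (Fin n) → Poly n → Poly n
[ U ]act P = sumP (map (λ σ → act σ P) (S U))

[_]'act : ∀ {n} → List (Fin n) → Poly n → Poly n
[ U ]'act P = sumP (map (λ σ → sgn σ • act σ P) (S U))

QI : ∀ {n} → ℕ → Poly n → Set
QI {n} m P = (a b : Fin n) → ¬ (a ≡ b) →
  ((var a ⊖ var b) ^ (2 ℕ.* m ℕ.+ 1)) ∣ (P ⊖ act (transp a b) P)

-- Tableaux of shape [n-1,1] (French convention).
-- row1 = first (bottom) row, left to right; row2 = the single entry of
-- the second row (sitting above the first entry of row1).
-- Entry i is represented by  i-1 : Fin n.

record Tableau (n : ℕ) : Set where
  constructor tab
  field
    row1 : List (Fin n)
    row2 : Fin n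
open Tableau public

colIncr : ∀ {n} → List (Fin n) → Fin n → Set
colIncr []      j = ⊥
colIncr (a ∷ _) j = a Fin.< j

record IsStandard {n : ℕ} (T : Tableau n) : Set where
  field
    shape    : length (row1 T) ≡ n ∸ 1
    bijective : (row2 T ∷ row1 T) ↭ allFin n
    rowIncr  : Linked Fin._<_ (row1 T)
    colIncr′ : colIncr (row1 T) (row2 T)

rows : ∀ {n} → Tableau n → List (List (Fin n))
rows T = row1 T ∷ (row2 T ∷ []) ∷ []

columns : ∀ {n} → Tableau n → List (List (Fin n))
columns (tab []       j) = (j ∷ []) ∷ []
columns (tab (a ∷ as) j) = (a ∷ j ∷ []) ∷ map (λ b → b ∷ []) as

N-act : ∀ {n} → Tableau n → Poly n → Poly n
N-act T P = foldr [_]'act P (columns T)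

P-act : ∀ {n} → Tableau n → Poly n → Poly n
P-act T P = foldr [_]act P (rows T)

-- γ_T = (f_λ / n!) N(T) P(T),  f_λ = n - 1
γ-act : ∀ {n} → Tableau n → Poly n → Poly n
γ-act {n} T P = ((+ (n ∸ 1) ℚ./ (n !)) {{n !≢0}}) • N-act T (P-act T P)

_∈γQI_ : ∀ {n} → Poly n → (Tableau n × ℕ) → Set
_∈γQI_ {n} F (T , m) = Σ (Poly n) λ P → QI m P × (F ≈ γ-act T P)

-- Polynomials in t with coefficients in ℚ[x₁,…,xₙ] (ascending coefficient lists)

TPoly : ℕ → Set
TPoly n = List (Poly n)

tadd : ∀ {n} → TPoly n → TPoly n → TPoly n
tadd [] q = q
tadd (a ∷ p) [] = a ∷ p
tadd (a ∷ p) (b ∷ q) = (a ⊕ b) ∷ tadd p q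

tscale : ∀ {n} → Poly n → TPoly n → TPoly n
tscale c = map (c ⊗_)

tmul : ∀ {n} → TPoly n → TPoly n → TPoly n
tmul []      q = []
tmul (a ∷ p) q = tadd (tscale a q) (con 0ℚ ∷ tmul p q)

tone : ∀ {n} → TPoly n
tone = con 1ℚ ∷ []

tpow : ∀ {n} → TPoly n → ℕ → TPoly n
tpow p zero    = tone
tpow p (suc k) = tmul p (tpow p k)

tprod : ∀ {n} → List (TPoly n) → TPoly n
tprod = foldr tmul tone

tvar : ∀ {n} → TPoly n
tvar = con 0ℚ ∷ con 1ℚ ∷ []

tminus : ∀ {n} → Fin n → TPoly n
tminus i = neg (var i) ∷ con 1ℚ ∷ []

antideriv′ : ∀ {n} → ℕ → TPoly n → TPoly n
antideriv′ i []      = []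
antideriv′ i (c ∷ p) = ((+ 1 ℚ./ suc i) • c) ∷ antideriv′ (suc i) p

antideriv : ∀ {n} → TPoly n → TPoly n
antideriv p = con 0ℚ ∷ antideriv′ 0 p

tevalAt : ∀ {n} → TPoly n → Poly n → Poly n
tevalAt []      a = con 0ℚ
tevalAt (c ∷ p) a = c ⊕ a ⊗ tevalAt p a

integral : ∀ {n} → Poly n → Poly n → TPoly n → Poly n
integral a b f = tevalAt (antideriv f) b ⊖ tevalAt (antideriv f) a

integrand : ℕ → ℕ → (n : ℕ) → TPoly n
integrand k m n = tmul (tpow tvar k) (tprod (map (λ i → tpow (tminus i) m) (allFin n)))

one : ∀ {n} → 2 ≤ n → Fin n
one (s≤s _) = Fin.zero

Q : ∀ {n} → 2 ≤ n → Tableau n → ℕ → ℕ → Poly n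
Q {n} h T k m = integral (var (one h)) (var (row2 T)) (integrand k m n)

-- Let L(t) = t^k ∏ᵢ (t − xᵢ)^m and Φ its antiderivative, so that Q = Φ(x_j) − Φ(x₁); L is
-- symmetric in x₁,…,xₙ. Substituting t = x_a + (x_b − x_a) s gives
-- Φ(x_b) − Φ(x_a) = (x_b − x_a) ∫₀¹ L(x_a + (x_b − x_a) s) ds, and the factors (t − x_a)^m,
-- (t − x_b)^m each contribute (x_b − x_a)^m, so (x_b − x_a)^{2m+1} divides Φ(x_b) − Φ(x_a).
-- A transposition (a b) changes Q by an integer combination of such differences, hence
-- Q ∈ QI_m. As for γ_T: the row symmetriser turns Q into
-- (n−1)! Φ(x_j) − (n−2)! Σ_{i ≠ j} Φ(x_i), the column antisymmetriser is 1 − (1 j), and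
-- their composite is ((n−1)! + (n−2)!)(Φ(x_j) − Φ(x₁)) = (n!/(n−1)) Q, so γ_T Q = Q.
module Submission where

open import Data.Nat as ℕ using (ℕ; zero; suc; _!; s≤s; z≤n; _∸_; _≤_)
import Data.Nat.Properties as ℕ
import Data.Integer as ℤ
import Data.Integer.Properties as ℤ
open import Data.Rational as ℚ using (ℚ; 0ℚ; 1ℚ; _+_; _*_; -_; _-_; toℚᵘ)
open import Data.Rational.Properties
  using ( +-identityˡ; +-identityʳ; +-assoc; +-inverseʳ
        ; *-identityˡ; *-identityʳ; *-assoc; *-comm; *-zeroˡ; *-zeroʳ
        ; *-distribˡ-+; *-distribʳ-+; +-*-ring; +-*-commutativeRing
        ; toℚᵘ-injective; toℚᵘ-fromℚᵘ; toℚᵘ-homo-+; toℚᵘ-homo-*)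
import Data.Rational.Properties as ℚ
import Data.Rational.Unnormalised as ℚᵘ
import Data.Rational.Unnormalised.Properties as ℚᵘ
open import Algebra.Bundles using (Ring)
open import Algebra.Properties.Semiring.Mult (Ring.semiring +-*-ring) using (×-homo-+; ×1-homo-*) renaming (_×_ to _×ℚ_)
open import Data.Fin as Fin using (Fin; _≟_; toℕ)
import Data.Fin.Properties as Fin
open import Data.Bool using (Bool; true; false)
open import Data.Nat.ListAction using (sum)
open import Data.Nat.ListAction.Properties using (sum-++)
open import Data.List using (List; []; _∷_; map; foldr; allFin; _++_; length; concatMap; filter; tabulate)
open import Data.List.Properties using (map-∘; map-cong; map-cong-local; map-++; length-map; map-tabulate)
open import Data.List.Relation.Unary.All as All using (All; []; _∷_)
import Data.List.Relation.Unary.All.Properties as All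
import Data.List.Relation.Unary.AllPairs as AllPairs
open AllPairs using ([]; _∷_)
open import Data.List.Relation.Unary.Any using (here; there)
import Data.List.Relation.Unary.Linked.Properties as Linked
open import Data.List.Relation.Unary.Unique.Propositional using (Unique)
import Data.List.Relation.Unary.Unique.Propositional.Properties as Unique
open import Data.List.Relation.Binary.Permutation.Propositional
  using (_↭_; ↭-sym; ↭-trans; ↭-prep; ↭-swap; ↭-refl; ↭⇒↭ₛ)
import Data.List.Relation.Binary.Permutation.Propositional as ↭
import Data.List.Relation.Binary.Permutation.Propositional.Properties as ↭
import Data.List.Relation.Binary.Permutation.Setoid.Properties as ↭ₛ
open import Data.List.Relation.Binary.BagAndSetEquality using (∼bag⇒↭)
open import Data.List.Membership.Propositional using (_∈_)
open import Data.List.Membership.Propositional.Properties using (∈-allFin; ∈-map⁺; ∈-∃++)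
open import Data.List.Membership.Propositional.Properties.WithK using (unique∧set⇒bag)
open import Data.Product using (Σ; _,_; proj₁; proj₂; _×_)
open import Data.Empty using (⊥-elim)
open import Function using (id; _∘_)
open import Function.Bundles using (mk⇔)
open import Relation.Nullary using (¬_; yes; no; does; Dec)
open import Relation.Nullary.Decidable.Core using (dec⇒maybe)
open import Relation.Binary using (Setoid)
import Relation.Binary.Reasoning.Setoid
open import Relation.Binary.PropositionalEquality
open import Tactic.RingSolver using (solve-∀)
open import Tactic.RingSolver.Core.AlmostCommutativeRing using (AlmostCommutativeRing; fromCommutativeRing)

open import Defs

ℚ-ring : AlmostCommutativeRing _ _
ℚ-ring = fromCommutativeRing +-*-commutativeRing (λ x → dec⇒maybe (0ℚ ℚ.≟ x))

fromℕ : ℕ → ℚ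
fromℕ n = n ×ℚ 1ℚ

1/suc : ℕ → ℚ
1/suc i = ℤ.+ 1 ℚ./ suc i

powℚ : ℚ → ℕ → ℚ
powℚ x zero    = 1ℚ
powℚ x (suc k) = x * powℚ x k

toℚᵘ-/suc : ∀ z d → toℚᵘ (z ℚ./ suc d) ℚᵘ.≃ ℚᵘ.mkℚᵘ z d
toℚᵘ-/suc z d = toℚᵘ-fromℚᵘ (ℚᵘ.mkℚᵘ z d)

fromℕ≡/1 : ∀ n → fromℕ n ≡ ℤ.+ n ℚ./ 1
fromℕ≡/1 zero    = refl
fromℕ≡/1 (suc n) = trans (cong (1ℚ +_) (fromℕ≡/1 n)) (toℚᵘ-injective
  (ℚᵘ.≃-trans (toℚᵘ-homo-+ 1ℚ (ℤ.+ n ℚ./ 1))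
  (ℚᵘ.≃-trans (ℚᵘ.+-cong (toℚᵘ-/suc (ℤ.+ 1) 0) (toℚᵘ-/suc (ℤ.+ n) 0))
  (ℚᵘ.≃-trans (ℚᵘ.*≡* cross) (ℚᵘ.≃-sym (toℚᵘ-/suc (ℤ.+ suc n) 0))))))
  where
  cross : (ℤ.+ 1 ℤ.* ℤ.+ 1 ℤ.+ ℤ.+ n ℤ.* ℤ.+ 1) ℤ.* ℤ.+ 1 ≡ ℤ.+ suc n ℤ.* ℤ.+ (1 ℕ.* 1)
  cross = trans (ℤ.*-identityʳ _) (trans (cong (λ z → ℤ.+ 1 ℤ.+ z) (ℤ.*-identityʳ (ℤ.+ n))) (sym (ℤ.*-identityʳ _)))

/-*-cancel : ∀ a d .{{_ : ℕ.NonZero d}} → (ℤ.+ a ℚ./ d) * fromℕ d ≡ fromℕ a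
/-*-cancel a (suc d) = begin
  (ℤ.+ a ℚ./ suc d) * fromℕ (suc d)     ≡⟨ cong ((ℤ.+ a ℚ./ suc d) *_) (fromℕ≡/1 (suc d)) ⟩
  (ℤ.+ a ℚ./ suc d) * (ℤ.+ suc d ℚ./ 1) ≡⟨ toℚᵘ-injective (ℚᵘ.≃-trans (toℚᵘ-homo-* (ℤ.+ a ℚ./ suc d) (ℤ.+ suc d ℚ./ 1))
                                            (ℚᵘ.≃-trans (ℚᵘ.*-cong (toℚᵘ-/suc (ℤ.+ a) d) (toℚᵘ-/suc (ℤ.+ suc d) 0))
                                            (ℚᵘ.≃-trans (ℚᵘ.*≡* cross) (ℚᵘ.≃-sym (toℚᵘ-/suc (ℤ.+ a) 0))))) ⟩
  ℤ.+ a ℚ./ 1                           ≡⟨ fromℕ≡/1 a ⟨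
  fromℕ a                               ∎
  where
  open ≡-Reasoning
  cross : (ℤ.+ a ℤ.* ℤ.+ suc d) ℤ.* ℤ.+ 1 ≡ ℤ.+ a ℤ.* ℤ.+ (suc d ℕ.* 1)
  cross = trans (ℤ.*-identityʳ _) (cong (λ z → ℤ.+ a ℤ.* ℤ.+ z) (sym (ℕ.*-identityʳ (suc d))))

1/suc-inverseˡ : ∀ r → 1/suc r * fromℕ (suc r) ≡ 1ℚ
1/suc-inverseˡ r = /-*-cancel 1 (suc r)

-- Polynomials in one variable over ℚ, as coefficient lists compared up to trailing zeros

Poly₁ : Set
Poly₁ = List ℚ

coeff : Poly₁ → ℕ → ℚ
coeff []      _       = 0ℚ
coeff (c ∷ p) zero    = c
coeff (c ∷ p) (suc i) = coeff p i

infix 4 _≋_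
record _≋_ (p q : Poly₁) : Set where
  constructor mk≋
  field at : ∀ i → coeff p i ≡ coeff q i
open _≋_ public

≋-refl : ∀ {p} → p ≋ p
≋-refl = mk≋ λ _ → refl

≋-sym : ∀ {p q} → p ≋ q → q ≋ p
≋-sym h = mk≋ λ i → sym (at h i)

≋-trans : ∀ {p q r} → p ≋ q → q ≋ r → p ≋ r
≋-trans h k = mk≋ λ i → trans (at h i) (at k i)

≋-setoid : Setoid _ _
≋-setoid = record
  { Carrier = Poly₁ ; _≈_ = _≋_
  ; isEquivalence = record { refl = ≋-refl ; sym = ≋-sym ; trans = ≋-trans } }

module ≋-Reasoning = Relation.Binary.Reasoning.Setoid ≋-setoid

≋-∷ : ∀ {a b p q} → a ≡ b → p ≋ q → (a ∷ p) ≋ (b ∷ q)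
≋-∷ e h = mk≋ λ { zero → e ; (suc i) → at h i }

≋-tail : ∀ {a b p q} → (a ∷ p) ≋ (b ∷ q) → p ≋ q
≋-tail h = mk≋ λ i → at h (suc i)

[]≋[0] : [] ≋ (0ℚ ∷ [])
[]≋[0] = mk≋ λ { zero → refl ; (suc i) → refl }

add : Poly₁ → Poly₁ → Poly₁
add []      q       = q
add (a ∷ p) []      = a ∷ p
add (a ∷ p) (b ∷ q) = (a + b) ∷ add p q

scale : ℚ → Poly₁ → Poly₁
scale c = map (c *_)

mul : Poly₁ → Poly₁ → Poly₁
mul []      q = []
mul (a ∷ p) q = add (scale a q) (0ℚ ∷ mul p q)

coeff-add : ∀ p q i → coeff (add p q) i ≡ coeff p i + coeff q i
coeff-add []      q       i       = sym (+-identityˡ _)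
coeff-add (a ∷ p) []      i       = sym (+-identityʳ _)
coeff-add (a ∷ p) (b ∷ q) zero    = refl
coeff-add (a ∷ p) (b ∷ q) (suc i) = coeff-add p q i

coeff-scale : ∀ c p i → coeff (scale c p) i ≡ c * coeff p i
coeff-scale c []      i       = sym (*-zeroʳ c)
coeff-scale c (a ∷ p) zero    = refl
coeff-scale c (a ∷ p) (suc i) = coeff-scale c p i

add-cong : ∀ {p p′ q q′} → p ≋ p′ → q ≋ q′ → add p q ≋ add p′ q′
add-cong {p} {p′} {q} {q′} h k = mk≋ λ i →
  trans (coeff-add p q i) (trans (cong₂ _+_ (at h i) (at k i)) (sym (coeff-add p′ q′ i)))

add-congʳ : ∀ p {q q′} → q ≋ q′ → add p q ≋ add p q′
add-congʳ p = add-cong {p} ≋-refl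

scale-cong : ∀ c {p q} → p ≋ q → scale c p ≋ scale c q
scale-cong c {p} {q} h = mk≋ λ i →
  trans (coeff-scale c p i) (trans (cong (c *_) (at h i)) (sym (coeff-scale c q i)))

scale-congˡ : ∀ {c c′} p → c ≡ c′ → scale c p ≋ scale c′ p
scale-congˡ p refl = ≋-refl

add-[]ʳ : ∀ p → add p [] ≋ p
add-[]ʳ []      = ≋-refl
add-[]ʳ (a ∷ p) = ≋-refl

add-≋[] : ∀ p {q} → q ≋ [] → add p q ≋ p
add-≋[] p h = ≋-trans (add-congʳ p h) (add-[]ʳ p)

add-[0]ˡ : ∀ p → add (0ℚ ∷ []) p ≋ p
add-[0]ˡ []      = ≋-sym []≋[0]
add-[0]ˡ (a ∷ p) = ≋-∷ (+-identityˡ a) ≋-refl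

add-interchange : ∀ x y z w → add (add x y) (add z w) ≋ add (add x z) (add y w)
add-interchange x y z w = mk≋ λ i → begin
  coeff (add (add x y) (add z w)) i                 ≡⟨ coeff-add (add x y) (add z w) i ⟩
  coeff (add x y) i + coeff (add z w) i             ≡⟨ cong₂ _+_ (coeff-add x y i) (coeff-add z w i) ⟩
  (coeff x i + coeff y i) + (coeff z i + coeff w i) ≡⟨ interchange (coeff x i) (coeff y i) (coeff z i) (coeff w i) ⟩
  (coeff x i + coeff z i) + (coeff y i + coeff w i) ≡⟨ cong₂ _+_ (coeff-add x z i) (coeff-add y w i) ⟨
  coeff (add x z) i + coeff (add y w) i             ≡⟨ coeff-add (add x z) (add y w) i ⟨
  coeff (add (add x z) (add y w)) i                 ∎
  where
  open ≡-Reasoning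
  interchange : ∀ a b c d → (a + b) + (c + d) ≡ (a + c) + (b + d)
  interchange = solve-∀ ℚ-ring

add-shuffle : ∀ x y z w → add x (add y (add z w)) ≋ add (add y z) (add x w)
add-shuffle x y z w = mk≋ λ i → begin
  coeff (add x (add y (add z w))) i                 ≡⟨ coeff-add x _ i ⟩
  coeff x i + coeff (add y (add z w)) i             ≡⟨ cong (coeff x i +_) (trans (coeff-add y _ i) (cong (coeff y i +_) (coeff-add z w i))) ⟩
  coeff x i + (coeff y i + (coeff z i + coeff w i)) ≡⟨ shuffle (coeff x i) (coeff y i) (coeff z i) (coeff w i) ⟩
  (coeff y i + coeff z i) + (coeff x i + coeff w i) ≡⟨ cong₂ _+_ (coeff-add y z i) (coeff-add x w i) ⟨
  coeff (add y z) i + coeff (add x w) i             ≡⟨ coeff-add (add y z) (add x w) i ⟨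
  coeff (add (add y z) (add x w)) i                 ∎
  where
  open ≡-Reasoning
  shuffle : ∀ a b c d → a + (b + (c + d)) ≡ (b + c) + (a + d)
  shuffle = solve-∀ ℚ-ring

scale-add : ∀ c x y → scale c (add x y) ≋ add (scale c x) (scale c y)
scale-add c x y = mk≋ λ i → begin
  coeff (scale c (add x y)) i               ≡⟨ coeff-scale c (add x y) i ⟩
  c * coeff (add x y) i                     ≡⟨ cong (c *_) (coeff-add x y i) ⟩
  c * (coeff x i + coeff y i)               ≡⟨ *-distribˡ-+ c _ _ ⟩
  c * coeff x i + c * coeff y i             ≡⟨ cong₂ _+_ (coeff-scale c x i) (coeff-scale c y i) ⟨
  coeff (scale c x) i + coeff (scale c y) i ≡⟨ coeff-add (scale c x) (scale c y) i ⟨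
  coeff (add (scale c x) (scale c y)) i     ∎
  where open ≡-Reasoning

scale-addˡ : ∀ c d x → scale (c + d) x ≋ add (scale c x) (scale d x)
scale-addˡ c d x = mk≋ λ i → begin
  coeff (scale (c + d) x) i                 ≡⟨ coeff-scale (c + d) x i ⟩
  (c + d) * coeff x i                       ≡⟨ *-distribʳ-+ _ c d ⟩
  c * coeff x i + d * coeff x i             ≡⟨ cong₂ _+_ (coeff-scale c x i) (coeff-scale d x i) ⟨
  coeff (scale c x) i + coeff (scale d x) i ≡⟨ coeff-add (scale c x) (scale d x) i ⟨
  coeff (add (scale c x) (scale d x)) i     ∎
  where open ≡-Reasoning

scale-scale : ∀ c d x → scale c (scale d x) ≋ scale (c * d) x
scale-scale c d x = mk≋ λ i → begin
  coeff (scale c (scale d x)) i ≡⟨ coeff-scale c (scale d x) i ⟩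
  c * coeff (scale d x) i       ≡⟨ cong (c *_) (coeff-scale d x i) ⟩
  c * (d * coeff x i)           ≡⟨ *-assoc c d _ ⟨
  (c * d) * coeff x i           ≡⟨ coeff-scale (c * d) x i ⟨
  coeff (scale (c * d) x) i     ∎
  where open ≡-Reasoning

scale-0 : ∀ x → scale 0ℚ x ≋ []
scale-0 x = mk≋ λ i → trans (coeff-scale 0ℚ x i) (*-zeroˡ (coeff x i))

scale-0∷ : ∀ c x → scale c (0ℚ ∷ x) ≋ (0ℚ ∷ scale c x)
scale-0∷ c x = ≋-∷ (*-zeroʳ c) ≋-refl

0∷-add : ∀ x y → (0ℚ ∷ add x y) ≋ add (0ℚ ∷ x) (0ℚ ∷ y)
0∷-add x y = ≋-∷ (sym (+-identityˡ 0ℚ)) ≋-refl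

mul-congʳ : ∀ p {q q′} → q ≋ q′ → mul p q ≋ mul p q′
mul-congʳ []      h = ≋-refl
mul-congʳ (a ∷ p) h = add-cong (scale-cong a h) (≋-∷ refl (mul-congʳ p h))

mul-0∷ˡ : ∀ p q → mul (0ℚ ∷ p) q ≋ (0ℚ ∷ mul p q)
mul-0∷ˡ p q = add-cong (scale-0 q) ≋-refl

mul-0∷ʳ : ∀ p q → mul p (0ℚ ∷ q) ≋ (0ℚ ∷ mul p q)
mul-0∷ʳ []      q = []≋[0]
mul-0∷ʳ (a ∷ p) q = ≋-∷ (trans (+-identityʳ (a * 0ℚ)) (*-zeroʳ a)) (add-congʳ (scale a q) (mul-0∷ʳ p q))

mul-[]ʳ : ∀ p → mul p [] ≋ []
mul-[]ʳ []      = ≋-refl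
mul-[]ʳ (a ∷ p) = ≋-trans (≋-∷ refl (mul-[]ʳ p)) (≋-sym []≋[0])

mul-[c]ʳ : ∀ p c → mul p (c ∷ []) ≋ scale c p
mul-[c]ʳ []      c = ≋-refl
mul-[c]ʳ (a ∷ p) c = ≋-∷ (trans (+-identityʳ (a * c)) (*-comm a c)) (mul-[c]ʳ p c)

mul-[c]ˡ : ∀ c p → mul (c ∷ []) p ≋ scale c p
mul-[c]ˡ c p = add-≋[] (scale c p) (≋-sym []≋[0])

mul-scaleˡ : ∀ c p q → mul (scale c p) q ≋ scale c (mul p q)
mul-scaleˡ c []      q = ≋-refl
mul-scaleˡ c (a ∷ p) q = begin
  add (scale (c * a) q) (0ℚ ∷ mul (scale c p) q)   ≈⟨ add-cong (≋-sym (scale-scale c a q)) (≋-∷ refl (mul-scaleˡ c p q)) ⟩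
  add (scale c (scale a q)) (0ℚ ∷ scale c (mul p q)) ≈⟨ add-congʳ (scale c (scale a q)) (scale-0∷ c (mul p q)) ⟨
  add (scale c (scale a q)) (scale c (0ℚ ∷ mul p q)) ≈⟨ scale-add c (scale a q) (0ℚ ∷ mul p q) ⟨
  scale c (mul (a ∷ p) q)                            ∎
  where open ≋-Reasoning

mul-scaleʳ : ∀ c p q → mul p (scale c q) ≋ scale c (mul p q)
mul-scaleʳ c []      q = ≋-refl
mul-scaleʳ c (a ∷ p) q = begin
  add (scale a (scale c q)) (0ℚ ∷ mul p (scale c q)) ≈⟨ add-cong (scale-scale a c q) (≋-∷ refl (mul-scaleʳ c p q)) ⟩
  add (scale (a * c) q) (0ℚ ∷ scale c (mul p q))     ≈⟨ add-cong (scale-congˡ q (*-comm a c)) (≋-sym (scale-0∷ c (mul p q))) ⟩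
  add (scale (c * a) q) (scale c (0ℚ ∷ mul p q))     ≈⟨ add-cong (≋-sym (scale-scale c a q)) ≋-refl ⟩
  add (scale c (scale a q)) (scale c (0ℚ ∷ mul p q)) ≈⟨ scale-add c (scale a q) (0ℚ ∷ mul p q) ⟨
  scale c (mul (a ∷ p) q)                            ∎
  where open ≋-Reasoning

mul-distribˡ : ∀ p q r → mul p (add q r) ≋ add (mul p q) (mul p r)
mul-distribˡ []      q r = ≋-refl
mul-distribˡ (a ∷ p) q r =
  ≋-trans (add-cong (scale-add a q r) (≋-trans (≋-∷ refl (mul-distribˡ p q r)) (0∷-add (mul p q) (mul p r))))
          (add-interchange (scale a q) (scale a r) (0ℚ ∷ mul p q) (0ℚ ∷ mul p r))

mul-distribʳ : ∀ p p′ q → mul (add p p′) q ≋ add (mul p q) (mul p′ q)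
mul-distribʳ []      p′       q = ≋-refl
mul-distribʳ (a ∷ p) []       q = ≋-sym (add-[]ʳ _)
mul-distribʳ (a ∷ p) (b ∷ p′) q =
  ≋-trans (add-cong (scale-addˡ a b q) (≋-trans (≋-∷ refl (mul-distribʳ p p′ q)) (0∷-add (mul p q) (mul p′ q))))
          (add-interchange (scale a q) (scale b q) (0ℚ ∷ mul p q) (0ℚ ∷ mul p′ q))

mul-comm : ∀ p q → mul p q ≋ mul q p
mul-comm []      q = ≋-sym (mul-[]ʳ q)
mul-comm (a ∷ p) q = begin
  add (scale a q) (0ℚ ∷ mul p q)       ≈⟨ add-cong (≋-sym (mul-[c]ʳ q a)) (≋-∷ refl (mul-comm p q)) ⟩
  add (mul q (a ∷ [])) (0ℚ ∷ mul q p)  ≈⟨ add-congʳ (mul q (a ∷ [])) (mul-0∷ʳ q p) ⟨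
  add (mul q (a ∷ [])) (mul q (0ℚ ∷ p)) ≈⟨ mul-distribˡ q (a ∷ []) (0ℚ ∷ p) ⟨
  mul q ((a + 0ℚ) ∷ p)                 ≈⟨ mul-congʳ q (≋-∷ (+-identityʳ a) ≋-refl) ⟩
  mul q (a ∷ p)                        ∎
  where open ≋-Reasoning

mul-congˡ : ∀ {p p′} → p ≋ p′ → ∀ q → mul p q ≋ mul p′ q
mul-congˡ {p} {p′} h q = ≋-trans (mul-comm p q) (≋-trans (mul-congʳ q h) (mul-comm q p′))

mul-cong : ∀ {p p′ q q′} → p ≋ p′ → q ≋ q′ → mul p q ≋ mul p′ q′
mul-cong {p′ = p′} {q} h k = ≋-trans (mul-congˡ h q) (mul-congʳ p′ k)

mul-assoc : ∀ p q r → mul (mul p q) r ≋ mul p (mul q r)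
mul-assoc []      q r = ≋-refl
mul-assoc (a ∷ p) q r =
  ≋-trans (mul-distribʳ (scale a q) (0ℚ ∷ mul p q) r)
          (add-cong (mul-scaleˡ a q r) (≋-trans (mul-0∷ˡ (mul p q) r) (≋-∷ refl (mul-assoc p q r))))

mul-scale-scale : ∀ A B C R c → mul A (mul (scale c B) (mul (scale c C) R)) ≋ scale (c * c) (mul A (mul B (mul C R)))
mul-scale-scale A B C R c = begin
  mul A (mul (scale c B) (mul (scale c C) R))   ≈⟨ mul-congʳ A (mul-congʳ (scale c B) (mul-scaleˡ c C R)) ⟩
  mul A (mul (scale c B) (scale c (mul C R)))   ≈⟨ mul-congʳ A (mul-scaleˡ c B (scale c (mul C R))) ⟩
  mul A (scale c (mul B (scale c (mul C R))))   ≈⟨ mul-congʳ A (scale-cong c (mul-scaleʳ c B (mul C R))) ⟩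
  mul A (scale c (scale c (mul B (mul C R))))   ≈⟨ mul-congʳ A (scale-scale c c _) ⟩
  mul A (scale (c * c) (mul B (mul C R)))       ≈⟨ mul-scaleʳ (c * c) A _ ⟩
  scale (c * c) (mul A (mul B (mul C R)))       ∎
  where open ≋-Reasoning

mul-swap : ∀ x y z → mul x (mul y z) ≋ mul y (mul x z)
mul-swap x y z = ≋-trans (≋-sym (mul-assoc x y z)) (≋-trans (mul-congˡ (mul-comm x y) z) (mul-assoc y x z))

eval : Poly₁ → ℚ → ℚ
eval []      t = 0ℚ
eval (c ∷ p) t = c + t * eval p t

eval-add : ∀ p q t → eval (add p q) t ≡ eval p t + eval q t
eval-add []      q       t = sym (+-identityˡ _)
eval-add (a ∷ p) []      t = sym (+-identityʳ _)
eval-add (a ∷ p) (b ∷ q) t = trans (cong (λ z → (a + b) + t * z) (eval-add p q t)) (horner a b t (eval p t) (eval q t))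
  where
  horner : ∀ a b t x y → (a + b) + t * (x + y) ≡ (a + t * x) + (b + t * y)
  horner = solve-∀ ℚ-ring

eval-scale : ∀ c p t → eval (scale c p) t ≡ c * eval p t
eval-scale c []      t = sym (*-zeroʳ c)
eval-scale c (a ∷ p) t = trans (cong (λ z → c * a + t * z) (eval-scale c p t)) (horner c a t (eval p t))
  where
  horner : ∀ c a t x → c * a + t * (c * x) ≡ c * (a + t * x)
  horner = solve-∀ ℚ-ring

eval-mul : ∀ p q t → eval (mul p q) t ≡ eval p t * eval q t
eval-mul []      q t = sym (*-zeroˡ (eval q t))
eval-mul (a ∷ p) q t = begin
  eval (add (scale a q) (0ℚ ∷ mul p q)) t          ≡⟨ eval-add (scale a q) (0ℚ ∷ mul p q) t ⟩
  eval (scale a q) t + (0ℚ + t * eval (mul p q) t) ≡⟨ cong₂ (λ u v → u + (0ℚ + t * v)) (eval-scale a q t) (eval-mul p q t) ⟩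
  a * eval q t + (0ℚ + t * (eval p t * eval q t))  ≡⟨ horner a t (eval p t) (eval q t) ⟩
  (a + t * eval p t) * eval q t                    ∎
  where
  open ≡-Reasoning
  horner : ∀ a t x y → a * y + (0ℚ + t * (x * y)) ≡ (a + t * x) * y
  horner = solve-∀ ℚ-ring

eval-≋[] : ∀ p t → p ≋ [] → eval p t ≡ 0ℚ
eval-≋[] []      t h = refl
eval-≋[] (c ∷ p) t h = begin
  c + t * eval p t ≡⟨ cong₂ (λ u v → u + t * v) (at h zero) (eval-≋[] p t (≋-tail (≋-trans h []≋[0]))) ⟩
  0ℚ + t * 0ℚ      ≡⟨ trans (cong (0ℚ +_) (*-zeroʳ t)) (+-identityˡ 0ℚ) ⟩
  0ℚ               ∎
  where open ≡-Reasoning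

eval-cong : ∀ {p q} t → p ≋ q → eval p t ≡ eval q t
eval-cong {[]}    {q}     t h = sym (eval-≋[] q t (≋-sym h))
eval-cong {a ∷ p} {[]}    t h = eval-≋[] (a ∷ p) t h
eval-cong {a ∷ p} {b ∷ q} t h = cong₂ (λ u v → u + t * v) (at h zero) (eval-cong t (≋-tail h))

eval-0 : ∀ p → eval p 0ℚ ≡ coeff p 0
eval-0 []      = refl
eval-0 (c ∷ p) = trans (cong (c +_) (*-zeroˡ (eval p 0ℚ))) (+-identityʳ c)

anti′ : ℕ → Poly₁ → Poly₁
anti′ i []      = []
anti′ i (c ∷ p) = (1/suc i * c) ∷ anti′ (suc i) p

anti : Poly₁ → Poly₁
anti p = 0ℚ ∷ anti′ 0 p

coeff-anti′ : ∀ i p r → coeff (anti′ i p) r ≡ 1/suc (i ℕ.+ r) * coeff p r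
coeff-anti′ i []      r       = sym (*-zeroʳ (1/suc (i ℕ.+ r)))
coeff-anti′ i (c ∷ p) zero    = cong (λ z → 1/suc z * c) (sym (ℕ.+-identityʳ i))
coeff-anti′ i (c ∷ p) (suc r) = trans (coeff-anti′ (suc i) p r) (cong (λ z → 1/suc z * coeff p r) (sym (ℕ.+-suc i r)))

coeff-anti : ∀ p r → coeff (anti p) (suc r) ≡ 1/suc r * coeff p r
coeff-anti p r = coeff-anti′ 0 p r

anti-cong : ∀ {p q} → p ≋ q → anti p ≋ anti q
anti-cong {p} {q} h = mk≋ λ
  { zero    → refl
  ; (suc r) → trans (coeff-anti p r) (trans (cong (1/suc r *_) (at h r)) (sym (coeff-anti q r))) }

anti-scale : ∀ c p → anti (scale c p) ≋ scale c (anti p)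
anti-scale c p = mk≋ λ
  { zero    → sym (*-zeroʳ c)
  ; (suc r) → begin
      coeff (anti (scale c p)) (suc r) ≡⟨ coeff-anti (scale c p) r ⟩
      1/suc r * coeff (scale c p) r    ≡⟨ cong (1/suc r *_) (coeff-scale c p r) ⟩
      1/suc r * (c * coeff p r)        ≡⟨ swap (1/suc r) c (coeff p r) ⟩
      c * (1/suc r * coeff p r)        ≡⟨ cong (c *_) (coeff-anti p r) ⟨
      c * coeff (anti p) (suc r)       ≡⟨ coeff-scale c (anti p) (suc r) ⟨
      coeff (scale c (anti p)) (suc r) ∎ }
  where
  open ≡-Reasoning
  swap : ∀ a b x → a * (b * x) ≡ b * (a * x)
  swap = solve-∀ ℚ-ring

eval-anti-0 : ∀ p → eval (anti p) 0ℚ ≡ 0ℚ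
eval-anti-0 p = eval-0 (anti p)

deriv′ : ℕ → Poly₁ → Poly₁
deriv′ i []      = []
deriv′ i (c ∷ p) = (fromℕ i * c) ∷ deriv′ (suc i) p

deriv : Poly₁ → Poly₁
deriv []      = []
deriv (c ∷ p) = deriv′ 1 p

coeff-deriv′ : ∀ i p r → coeff (deriv′ i p) r ≡ fromℕ (i ℕ.+ r) * coeff p r
coeff-deriv′ i []      r       = sym (*-zeroʳ (fromℕ (i ℕ.+ r)))
coeff-deriv′ i (c ∷ p) zero    = cong (λ z → fromℕ z * c) (sym (ℕ.+-identityʳ i))
coeff-deriv′ i (c ∷ p) (suc r) = trans (coeff-deriv′ (suc i) p r) (cong (λ z → fromℕ z * coeff p r) (sym (ℕ.+-suc i r)))

coeff-deriv : ∀ p r → coeff (deriv p) r ≡ fromℕ (suc r) * coeff p (suc r)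
coeff-deriv []      r = sym (*-zeroʳ (fromℕ (suc r)))
coeff-deriv (c ∷ p) r = coeff-deriv′ 1 p r

deriv-add : ∀ p q → deriv (add p q) ≋ add (deriv p) (deriv q)
deriv-add p q = mk≋ λ r → begin
  coeff (deriv (add p q)) r                                   ≡⟨ coeff-deriv (add p q) r ⟩
  fromℕ (suc r) * coeff (add p q) (suc r)                     ≡⟨ cong (fromℕ (suc r) *_) (coeff-add p q (suc r)) ⟩
  fromℕ (suc r) * (coeff p (suc r) + coeff q (suc r))         ≡⟨ *-distribˡ-+ (fromℕ (suc r)) _ _ ⟩
  fromℕ (suc r) * coeff p (suc r) + fromℕ (suc r) * coeff q (suc r) ≡⟨ cong₂ _+_ (coeff-deriv p r) (coeff-deriv q r) ⟨
  coeff (deriv p) r + coeff (deriv q) r                       ≡⟨ coeff-add (deriv p) (deriv q) r ⟨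
  coeff (add (deriv p) (deriv q)) r                           ∎
  where open ≡-Reasoning

deriv-scale : ∀ c p → deriv (scale c p) ≋ scale c (deriv p)
deriv-scale c p = mk≋ λ r → begin
  coeff (deriv (scale c p)) r               ≡⟨ coeff-deriv (scale c p) r ⟩
  fromℕ (suc r) * coeff (scale c p) (suc r) ≡⟨ cong (fromℕ (suc r) *_) (coeff-scale c p (suc r)) ⟩
  fromℕ (suc r) * (c * coeff p (suc r))     ≡⟨ swap (fromℕ (suc r)) c (coeff p (suc r)) ⟩
  c * (fromℕ (suc r) * coeff p (suc r))     ≡⟨ cong (c *_) (coeff-deriv p r) ⟨
  c * coeff (deriv p) r                     ≡⟨ coeff-scale c (deriv p) r ⟨
  coeff (scale c (deriv p)) r               ∎
  where
  open ≡-Reasoning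
  swap : ∀ a b x → a * (b * x) ≡ b * (a * x)
  swap = solve-∀ ℚ-ring

deriv-∷ : ∀ c p → deriv (c ∷ p) ≋ add p (0ℚ ∷ deriv p)
deriv-∷ c p = mk≋ λ r → trans (coeff-deriv (c ∷ p) r) (trans (step r) (sym (coeff-add p (0ℚ ∷ deriv p) r)))
  where
  step : ∀ r → fromℕ (suc r) * coeff p r ≡ coeff p r + coeff (0ℚ ∷ deriv p) r
  step zero    = trans (cong (_* coeff p 0) (+-identityʳ 1ℚ)) (trans (*-identityˡ (coeff p 0)) (sym (+-identityʳ (coeff p 0))))
  step (suc r) = trans (distrib (fromℕ (suc r)) (coeff p (suc r))) (cong (coeff p (suc r) +_) (sym (coeff-deriv p r)))
    where
    distrib : ∀ n x → (1ℚ + n) * x ≡ x + n * x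
    distrib = solve-∀ ℚ-ring

deriv-anti : ∀ p → deriv (anti p) ≋ p
deriv-anti p = mk≋ λ r → begin
  coeff (deriv (anti p)) r               ≡⟨ coeff-deriv (anti p) r ⟩
  fromℕ (suc r) * coeff (anti p) (suc r) ≡⟨ cong (fromℕ (suc r) *_) (coeff-anti p r) ⟩
  fromℕ (suc r) * (1/suc r * coeff p r)  ≡⟨ *-assoc (fromℕ (suc r)) (1/suc r) (coeff p r) ⟨
  (fromℕ (suc r) * 1/suc r) * coeff p r  ≡⟨ cong (_* coeff p r) (trans (*-comm (fromℕ (suc r)) (1/suc r)) (1/suc-inverseˡ r)) ⟩
  1ℚ * coeff p r                         ≡⟨ *-identityˡ _ ⟩
  coeff p r                              ∎
  where open ≡-Reasoning

deriv-injective : ∀ p q → coeff p 0 ≡ coeff q 0 → deriv p ≋ deriv q → p ≋ q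
deriv-injective p q h₀ h′ = mk≋ λ
  { zero    → h₀
  ; (suc r) → begin
      coeff p (suc r)                             ≡⟨ cancel r (coeff p (suc r)) ⟨
      1/suc r * (fromℕ (suc r) * coeff p (suc r)) ≡⟨ cong (1/suc r *_) (trans (sym (coeff-deriv p r)) (trans (at h′ r) (coeff-deriv q r))) ⟩
      1/suc r * (fromℕ (suc r) * coeff q (suc r)) ≡⟨ cancel r (coeff q (suc r)) ⟩
      coeff q (suc r)                             ∎ }
  where
  open ≡-Reasoning
  cancel : ∀ r x → 1/suc r * (fromℕ (suc r) * x) ≡ x
  cancel r x = trans (sym (*-assoc (1/suc r) _ x)) (trans (cong (_* x) (1/suc-inverseˡ r)) (*-identityˡ x))

deriv-mul : ∀ p q → deriv (mul p q) ≋ add (mul (deriv p) q) (mul p (deriv q))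
deriv-mul []      q = ≋-refl
deriv-mul (a ∷ p) q = begin
  deriv (add (scale a q) (0ℚ ∷ mul p q))
    ≈⟨ deriv-add (scale a q) (0ℚ ∷ mul p q) ⟩
  add (deriv (scale a q)) (deriv (0ℚ ∷ mul p q))
    ≈⟨ add-cong (deriv-scale a q) (≋-trans (deriv-∷ 0ℚ (mul p q)) (add-congʳ (mul p q) (≋-∷ refl (deriv-mul p q)))) ⟩
  add (scale a (deriv q)) (add (mul p q) (0ℚ ∷ add (mul (deriv p) q) (mul p (deriv q))))
    ≈⟨ add-congʳ (scale a (deriv q)) (add-congʳ (mul p q) (0∷-add (mul (deriv p) q) (mul p (deriv q)))) ⟩
  add (scale a (deriv q)) (add (mul p q) (add (0ℚ ∷ mul (deriv p) q) (0ℚ ∷ mul p (deriv q))))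
    ≈⟨ add-shuffle (scale a (deriv q)) (mul p q) (0ℚ ∷ mul (deriv p) q) (0ℚ ∷ mul p (deriv q)) ⟩
  add (add (mul p q) (0ℚ ∷ mul (deriv p) q)) (mul (a ∷ p) (deriv q))
    ≈⟨ add-cong (add-congʳ (mul p q) (mul-0∷ˡ (deriv p) q)) ≋-refl ⟨
  add (add (mul p q) (mul (0ℚ ∷ deriv p) q)) (mul (a ∷ p) (deriv q))
    ≈⟨ add-cong (mul-distribʳ p (0ℚ ∷ deriv p) q) ≋-refl ⟨
  add (mul (add p (0ℚ ∷ deriv p)) q) (mul (a ∷ p) (deriv q))
    ≈⟨ add-cong (mul-congˡ (deriv-∷ a p) q) ≋-refl ⟨
  add (mul (deriv (a ∷ p)) q) (mul (a ∷ p) (deriv q))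
    ∎
  where open ≋-Reasoning

compAffine : ℚ → ℚ → Poly₁ → Poly₁
compAffine a d []      = []
compAffine a d (c ∷ q) = add (c ∷ []) (mul (a ∷ d ∷ []) (compAffine a d q))

eval-compAffine : ∀ a d q s → eval (compAffine a d q) s ≡ eval q (a + d * s)
eval-compAffine a d []      s = refl
eval-compAffine a d (c ∷ q) s = begin
  eval (add (c ∷ []) (mul (a ∷ d ∷ []) (compAffine a d q))) s
    ≡⟨ eval-add (c ∷ []) (mul (a ∷ d ∷ []) (compAffine a d q)) s ⟩
  (c + s * 0ℚ) + eval (mul (a ∷ d ∷ []) (compAffine a d q)) s
    ≡⟨ cong (λ z → (c + s * 0ℚ) + z) (trans (eval-mul (a ∷ d ∷ []) (compAffine a d q) s) (cong (eval (a ∷ d ∷ []) s *_) (eval-compAffine a d q s))) ⟩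
  (c + s * 0ℚ) + (a + s * (d + s * 0ℚ)) * eval q (a + d * s)
    ≡⟨ affine c a d s (eval q (a + d * s)) ⟩
  c + (a + d * s) * eval q (a + d * s)
    ∎
  where
  open ≡-Reasoning
  affine : ∀ c a d s x → (c + s * 0ℚ) + (a + s * (d + s * 0ℚ)) * x ≡ c + (a + d * s) * x
  affine = solve-∀ ℚ-ring

compAffine-≋[] : ∀ a d q → q ≋ [] → compAffine a d q ≋ []
compAffine-≋[] a d []      h = ≋-refl
compAffine-≋[] a d (c ∷ q) h =
  ≋-trans (add-cong (≋-∷ (at h zero) ≋-refl)
                    (≋-trans (mul-congʳ (a ∷ d ∷ []) (compAffine-≋[] a d q (≋-tail (≋-trans h []≋[0])))) (mul-[]ʳ (a ∷ d ∷ []))))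
          (≋-sym []≋[0])

compAffine-cong : ∀ a d {p q} → p ≋ q → compAffine a d p ≋ compAffine a d q
compAffine-cong a d {[]}    {q}      h = ≋-sym (compAffine-≋[] a d q (≋-sym h))
compAffine-cong a d {c ∷ p} {[]}     h = compAffine-≋[] a d (c ∷ p) h
compAffine-cong a d {c ∷ p} {c′ ∷ q} h =
  add-cong (≋-∷ (at h zero) ≋-refl) (mul-congʳ (a ∷ d ∷ []) (compAffine-cong a d (≋-tail h)))

compAffine-add : ∀ a d p q → compAffine a d (add p q) ≋ add (compAffine a d p) (compAffine a d q)
compAffine-add a d []      q        = ≋-refl
compAffine-add a d (c ∷ p) []       = ≋-sym (add-[]ʳ _)
compAffine-add a d (c ∷ p) (c′ ∷ q) =
  ≋-trans (add-congʳ ((c + c′) ∷ []) (≋-trans (mul-congʳ L (compAffine-add a d p q)) (mul-distribˡ L (compAffine a d p) (compAffine a d q))))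
          (add-interchange (c ∷ []) (c′ ∷ []) (mul L (compAffine a d p)) (mul L (compAffine a d q)))
  where L = a ∷ d ∷ []

compAffine-scale : ∀ a d c p → compAffine a d (scale c p) ≋ scale c (compAffine a d p)
compAffine-scale a d c []      = ≋-refl
compAffine-scale a d c (b ∷ p) =
  ≋-trans (add-congʳ ((c * b) ∷ []) (≋-trans (mul-congʳ L (compAffine-scale a d c p)) (mul-scaleʳ c L (compAffine a d p))))
          (≋-sym (scale-add c (b ∷ []) (mul L (compAffine a d p))))
  where L = a ∷ d ∷ []

compAffine-0∷ : ∀ a d p → compAffine a d (0ℚ ∷ p) ≋ mul (a ∷ d ∷ []) (compAffine a d p)
compAffine-0∷ a d p = add-[0]ˡ _

compAffine-const : ∀ a d c → compAffine a d (c ∷ []) ≋ (c ∷ [])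
compAffine-const a d c = add-≋[] (c ∷ []) (mul-[]ʳ (a ∷ d ∷ []))

compAffine-linear : ∀ a d c₀ c₁ → compAffine a d (c₀ ∷ c₁ ∷ []) ≋ ((c₀ + c₁ * a) ∷ (c₁ * d) ∷ [])
compAffine-linear a d c₀ c₁ =
  add-congʳ (c₀ ∷ []) (≋-trans (mul-congʳ (a ∷ d ∷ []) (compAffine-const a d c₁)) (mul-[c]ʳ (a ∷ d ∷ []) c₁))

compAffine-mul : ∀ a d p q → compAffine a d (mul p q) ≋ mul (compAffine a d p) (compAffine a d q)
compAffine-mul a d []      q = ≋-refl
compAffine-mul a d (c ∷ p) q = begin
  compAffine a d (add (scale c q) (0ℚ ∷ mul p q))
    ≈⟨ compAffine-add a d (scale c q) (0ℚ ∷ mul p q) ⟩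
  add (compAffine a d (scale c q)) (compAffine a d (0ℚ ∷ mul p q))
    ≈⟨ add-cong (compAffine-scale a d c q) (≋-trans (compAffine-0∷ a d (mul p q)) (mul-congʳ L (compAffine-mul a d p q))) ⟩
  add (scale c q′) (mul L (mul p′ q′))
    ≈⟨ add-cong (≋-sym (mul-[c]ˡ c q′)) (≋-sym (mul-assoc L p′ q′)) ⟩
  add (mul (c ∷ []) q′) (mul (mul L p′) q′)
    ≈⟨ mul-distribʳ (c ∷ []) (mul L p′) q′ ⟨
  mul (compAffine a d (c ∷ p)) q′
    ∎
  where
  open ≋-Reasoning
  L  = a ∷ d ∷ []
  p′ = compAffine a d p
  q′ = compAffine a d q

deriv-compAffine : ∀ a d q → deriv (compAffine a d q) ≋ scale d (compAffine a d (deriv q))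
deriv-compAffine a d []      = ≋-refl
deriv-compAffine a d (c ∷ q) = begin
  deriv (add (c ∷ []) (mul L q′))
    ≈⟨ deriv-add (c ∷ []) (mul L q′) ⟩
  add [] (deriv (mul L q′))
    ≈⟨ deriv-mul L q′ ⟩
  add (mul (deriv L) q′) (mul L (deriv q′))
    ≈⟨ add-cong (mul-congˡ deriv-L q′) (mul-congʳ L (deriv-compAffine a d q)) ⟩
  add (mul (d ∷ []) q′) (mul L (scale d (compAffine a d (deriv q))))
    ≈⟨ add-cong (mul-[c]ˡ d q′) (mul-scaleʳ d L (compAffine a d (deriv q))) ⟩
  add (scale d q′) (scale d (mul L (compAffine a d (deriv q))))
    ≈⟨ scale-add d q′ (mul L (compAffine a d (deriv q))) ⟨
  scale d (add q′ (mul L (compAffine a d (deriv q))))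
    ≈⟨ scale-cong d (add-congʳ q′ (compAffine-0∷ a d (deriv q))) ⟨
  scale d (add q′ (compAffine a d (0ℚ ∷ deriv q)))
    ≈⟨ scale-cong d (compAffine-add a d q (0ℚ ∷ deriv q)) ⟨
  scale d (compAffine a d (add q (0ℚ ∷ deriv q)))
    ≈⟨ scale-cong d (compAffine-cong a d (deriv-∷ c q)) ⟨
  scale d (compAffine a d (deriv (c ∷ q)))
    ∎
  where
  open ≋-Reasoning
  L  = a ∷ d ∷ []
  q′ = compAffine a d q
  deriv-L : deriv L ≋ (d ∷ [])
  deriv-L = ≋-∷ (trans (cong (_* d) (+-identityʳ 1ℚ)) (*-identityˡ d)) ≋-refl

coeff₀-compAffine : ∀ a d q → coeff (compAffine a d q) 0 ≡ eval q a
coeff₀-compAffine a d q =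
  trans (sym (eval-0 (compAffine a d q)))
        (trans (eval-compAffine a d q 0ℚ) (cong (eval q) (trans (cong (a +_) (*-zeroʳ d)) (+-identityʳ a))))

-- Both sides have derivative d · p(a + d t) and agree at t = 0.
compAffine-anti : ∀ a d p → compAffine a d (anti p) ≋ add (eval (anti p) a ∷ []) (scale d (anti (compAffine a d p)))
compAffine-anti a d p = deriv-injective _ _ agree-at-0 (begin
  deriv (compAffine a d (anti p))                      ≈⟨ deriv-compAffine a d (anti p) ⟩
  scale d (compAffine a d (deriv (anti p)))            ≈⟨ scale-cong d (compAffine-cong a d (deriv-anti p)) ⟩
  scale d (compAffine a d p)                           ≈⟨ scale-cong d (deriv-anti (compAffine a d p)) ⟨
  scale d (deriv (anti (compAffine a d p)))            ≈⟨ deriv-scale d (anti (compAffine a d p)) ⟨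
  deriv (add (Φa ∷ []) (scale d (anti (compAffine a d p)))) ∎)
  where
  open ≋-Reasoning
  Φa = eval (anti p) a
  agree-at-0 : coeff (compAffine a d (anti p)) 0 ≡ Φa + d * 0ℚ
  agree-at-0 = trans (coeff₀-compAffine a d (anti p)) (sym (trans (cong (Φa +_) (*-zeroʳ d)) (+-identityʳ Φa)))

eval-anti-affine : ∀ a d p s → eval (anti p) (a + d * s) ≡ eval (anti p) a + d * eval (anti (compAffine a d p)) s
eval-anti-affine a d p s = begin
  eval (anti p) (a + d * s)                            ≡⟨ eval-compAffine a d (anti p) s ⟨
  eval (compAffine a d (anti p)) s                     ≡⟨ eval-cong s (compAffine-anti a d p) ⟩
  eval (add (Φa ∷ []) (scale d (anti (compAffine a d p)))) s
    ≡⟨ eval-add (Φa ∷ []) (scale d (anti (compAffine a d p))) s ⟩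
  (Φa + s * 0ℚ) + eval (scale d (anti (compAffine a d p))) s
    ≡⟨ cong₂ _+_ (trans (cong (Φa +_) (*-zeroʳ s)) (+-identityʳ Φa)) (eval-scale d (anti (compAffine a d p)) s) ⟩
  Φa + d * eval (anti (compAffine a d p)) s            ∎
  where
  open ≡-Reasoning
  Φa = eval (anti p) a

pow : Poly₁ → ℕ → Poly₁
pow p zero    = 1ℚ ∷ []
pow p (suc k) = mul p (pow p k)

prod : List Poly₁ → Poly₁
prod = foldr mul (1ℚ ∷ [])

pow-cong : ∀ {p q} k → p ≋ q → pow p k ≋ pow q k
pow-cong zero    h = ≋-refl
pow-cong (suc k) h = mul-cong h (pow-cong k h)

prod-map-cong : ∀ {A : Set} {f g : A → Poly₁} (xs : List A) → (∀ x → f x ≋ g x) → prod (map f xs) ≋ prod (map g xs)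
prod-map-cong []       h = ≋-refl
prod-map-cong (x ∷ xs) h = mul-cong (h x) (prod-map-cong xs h)

prod-↭ : ∀ {xs ys} → xs ↭ ys → prod xs ≋ prod ys
prod-↭ ↭.refl          = ≋-refl
prod-↭ (↭.prep x h)    = mul-congʳ x (prod-↭ h)
prod-↭ (↭.swap x y h)  = ≋-trans (mul-congʳ x (mul-congʳ y (prod-↭ h))) (mul-swap x y _)
prod-↭ (↭.trans h h′)  = ≋-trans (prod-↭ h) (prod-↭ h′)

scale-pow : ∀ c p k → pow (scale c p) k ≋ scale (powℚ c k) (pow p k)
scale-pow c p zero    = ≋-∷ (sym (*-identityʳ 1ℚ)) ≋-refl
scale-pow c p (suc k) = begin
  mul (scale c p) (pow (scale c p) k)            ≈⟨ mul-congʳ (scale c p) (scale-pow c p k) ⟩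
  mul (scale c p) (scale (powℚ c k) (pow p k))   ≈⟨ mul-scaleʳ (powℚ c k) (scale c p) (pow p k) ⟩
  scale (powℚ c k) (mul (scale c p) (pow p k))   ≈⟨ scale-cong (powℚ c k) (mul-scaleˡ c p (pow p k)) ⟩
  scale (powℚ c k) (scale c (pow p (suc k)))     ≈⟨ scale-scale (powℚ c k) c _ ⟩
  scale (powℚ c k * c) (pow p (suc k))           ≈⟨ scale-congˡ _ (*-comm (powℚ c k) c) ⟩
  scale (powℚ c (suc k)) (pow p (suc k))         ∎
  where open ≋-Reasoning

compAffine-pow : ∀ a d p k → compAffine a d (pow p k) ≋ pow (compAffine a d p) k
compAffine-pow a d p zero    = compAffine-const a d 1ℚ
compAffine-pow a d p (suc k) = ≋-trans (compAffine-mul a d p (pow p k)) (mul-congʳ (compAffine a d p) (compAffine-pow a d p k))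

compAffine-prod : ∀ a d ps → compAffine a d (prod ps) ≋ prod (map (compAffine a d) ps)
compAffine-prod a d []       = compAffine-const a d 1ℚ
compAffine-prod a d (p ∷ ps) = ≋-trans (compAffine-mul a d p (prod ps)) (mul-congʳ (compAffine a d p) (compAffine-prod a d ps))

-- Reading a polynomial in t over ℚ[x₁,…,xₙ] at a point of ℚⁿ

instantiate : ∀ {n} → (Fin n → ℚ) → TPoly n → Poly₁
instantiate ρ = map (λ c → ⟦ c ⟧ ρ)

module _ {n} (ρ : Fin n → ℚ) where

  instantiate-tadd : ∀ p q → instantiate ρ (tadd p q) ≡ add (instantiate ρ p) (instantiate ρ q)
  instantiate-tadd []      q       = refl
  instantiate-tadd (a ∷ p) []      = refl
  instantiate-tadd (a ∷ p) (b ∷ q) = cong (_ ∷_) (instantiate-tadd p q)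

  instantiate-tscale : ∀ c p → instantiate ρ (tscale c p) ≡ scale (⟦ c ⟧ ρ) (instantiate ρ p)
  instantiate-tscale c []      = refl
  instantiate-tscale c (a ∷ p) = cong (_ ∷_) (instantiate-tscale c p)

  instantiate-tmul : ∀ p q → instantiate ρ (tmul p q) ≡ mul (instantiate ρ p) (instantiate ρ q)
  instantiate-tmul []      q = refl
  instantiate-tmul (a ∷ p) q = trans (instantiate-tadd (tscale a q) (con 0ℚ ∷ tmul p q))
    (cong₂ add (instantiate-tscale a q) (cong (0ℚ ∷_) (instantiate-tmul p q)))

  instantiate-tpow : ∀ p k → instantiate ρ (tpow p k) ≡ pow (instantiate ρ p) k
  instantiate-tpow p zero    = refl
  instantiate-tpow p (suc k) = trans (instantiate-tmul p (tpow p k)) (cong (mul (instantiate ρ p)) (instantiate-tpow p k))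

  instantiate-tprod : ∀ ps → instantiate ρ (tprod ps) ≡ prod (map (instantiate ρ) ps)
  instantiate-tprod []       = refl
  instantiate-tprod (p ∷ ps) = trans (instantiate-tmul p (tprod ps)) (cong (mul (instantiate ρ p)) (instantiate-tprod ps))

  instantiate-antideriv′ : ∀ i p → instantiate ρ (antideriv′ i p) ≡ anti′ i (instantiate ρ p)
  instantiate-antideriv′ i []      = refl
  instantiate-antideriv′ i (c ∷ p) = cong (_ ∷_) (instantiate-antideriv′ (suc i) p)

  instantiate-antideriv : ∀ p → instantiate ρ (antideriv p) ≡ anti (instantiate ρ p)
  instantiate-antideriv p = cong (0ℚ ∷_) (instantiate-antideriv′ 0 p)

  sem-tevalAt : ∀ p a → ⟦ tevalAt p a ⟧ ρ ≡ eval (instantiate ρ p) (⟦ a ⟧ ρ)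
  sem-tevalAt []      a = refl
  sem-tevalAt (c ∷ p) a = cong (λ z → ⟦ c ⟧ ρ + ⟦ a ⟧ ρ * z) (sem-tevalAt p a)

  sem-integral : ∀ a b f →
    ⟦ integral a b f ⟧ ρ ≡ eval (anti (instantiate ρ f)) (⟦ b ⟧ ρ) - eval (anti (instantiate ρ f)) (⟦ a ⟧ ρ)
  sem-integral a b f = cong₂ _-_ (value-at b) (value-at a)
    where
    value-at : ∀ x → ⟦ tevalAt (antideriv f) x ⟧ ρ ≡ eval (anti (instantiate ρ f)) (⟦ x ⟧ ρ)
    value-at x = trans (sem-tevalAt (antideriv f) x) (cong (λ z → eval z (⟦ x ⟧ ρ)) (instantiate-antideriv f))

sem-act : ∀ {n} (σ : Perm n) P (ρ : Fin n → ℚ) → ⟦ act σ P ⟧ ρ ≡ ⟦ P ⟧ (ρ ∘ σ)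
sem-act σ (con c) ρ = refl
sem-act σ (var i) ρ = refl
sem-act σ (p ⊕ q) ρ = cong₂ _+_ (sem-act σ p ρ) (sem-act σ q ρ)
sem-act σ (p ⊗ q) ρ = cong₂ _*_ (sem-act σ p ρ) (sem-act σ q ρ)
sem-act σ (neg p) ρ = cong -_ (sem-act σ p ρ)

sem-^ : ∀ {n} (p : Poly n) k ρ → ⟦ p ^ k ⟧ ρ ≡ powℚ (⟦ p ⟧ ρ) k
sem-^ p zero    ρ = refl
sem-^ p (suc k) ρ = cong (⟦ p ⟧ ρ *_) (sem-^ p k ρ)

sem-ext : ∀ {n} (P : Poly n) {ρ ρ′ : Fin n → ℚ} → (∀ i → ρ i ≡ ρ′ i) → ⟦ P ⟧ ρ ≡ ⟦ P ⟧ ρ′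
sem-ext (con c) h = refl
sem-ext (var i) h = h i
sem-ext (p ⊕ q) h = cong₂ _+_ (sem-ext p h) (sem-ext q h)
sem-ext (p ⊗ q) h = cong₂ _*_ (sem-ext p h) (sem-ext q h)
sem-ext (neg p) h = cong -_ (sem-ext p h)

integrandAt : ∀ {n} → (Fin n → ℚ) → ℕ → ℕ → Poly₁
integrandAt {n} ρ k m = mul (pow (0ℚ ∷ 1ℚ ∷ []) k) (prod (map (λ i → pow ((- ρ i) ∷ 1ℚ ∷ []) m) (allFin n)))

Φ : ∀ {n} → (Fin n → ℚ) → ℕ → ℕ → ℚ → ℚ
Φ ρ k m = eval (anti (integrandAt ρ k m))

instantiate-integrand : ∀ {n} (ρ : Fin n → ℚ) k m → instantiate ρ (integrand k m n) ≡ integrandAt ρ k m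
instantiate-integrand {n} ρ k m =
  trans (instantiate-tmul ρ (tpow tvar k) (tprod (map factor (allFin n))))
        (cong₂ mul (instantiate-tpow ρ tvar k)
                   (trans (instantiate-tprod ρ (map factor (allFin n)))
                          (cong prod (trans (sym (map-∘ (allFin n))) (map-cong (λ i → instantiate-tpow ρ (tminus i) m) (allFin n))))))
  where
  factor : Fin n → TPoly n
  factor i = tpow (tminus i) m

sem-Q : ∀ {n} (h : 2 ℕ.≤ n) (T : Tableau n) k m ρ → ⟦ Q h T k m ⟧ ρ ≡ Φ ρ k m (ρ (row2 T)) - Φ ρ k m (ρ (one h))
sem-Q {n} h T k m ρ = trans (sem-integral ρ (var (one h)) (var (row2 T)) (integrand k m n))
  (cong (λ L → eval (anti L) (ρ (row2 T)) - eval (anti L) (ρ (one h))) (instantiate-integrand ρ k m))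

IsPermutation : ∀ {n} → Perm n → Set
IsPermutation {n} σ = map σ (allFin n) ↭ allFin n

integrandAt-∘ : ∀ {n} (ρ : Fin n → ℚ) {σ} k m → IsPermutation σ → integrandAt (ρ ∘ σ) k m ≋ integrandAt ρ k m
integrandAt-∘ {n} ρ k m σ-perm = mul-congʳ (pow (0ℚ ∷ 1ℚ ∷ []) k)
  (subst (λ fs → prod fs ≋ prod (map factor (allFin n))) (sym (map-∘ (allFin n))) (prod-↭ (↭.map⁺ factor σ-perm)))
  where factor = λ i → pow ((- ρ i) ∷ 1ℚ ∷ []) m

Φ-∘ : ∀ {n} (ρ : Fin n → ℚ) {σ} k m → IsPermutation σ → ∀ x → Φ (ρ ∘ σ) k m x ≡ Φ ρ k m x
Φ-∘ ρ k m σ-perm x = eval-cong x (anti-cong (integrandAt-∘ ρ k m σ-perm))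

-- Divisibility of Φ(x_v) − Φ(x_u) by (x_v − x_u)^{2m+1}

powℚ-+ : ∀ x a b → powℚ x (a ℕ.+ b) ≡ powℚ x a * powℚ x b
powℚ-+ x zero    b = sym (*-identityˡ _)
powℚ-+ x (suc a) b = trans (cong (x *_) (powℚ-+ x a b)) (sym (*-assoc x _ _))

powℚ-2m+1 : ∀ x m → powℚ x (2 ℕ.* m ℕ.+ 1) ≡ x * (powℚ x m * powℚ x m)
powℚ-2m+1 x m = begin
  powℚ x (2 ℕ.* m ℕ.+ 1)       ≡⟨ cong (powℚ x) (ℕ.+-comm (2 ℕ.* m) 1) ⟩
  x * powℚ x (m ℕ.+ (m ℕ.+ 0)) ≡⟨ cong (λ z → x * powℚ x (m ℕ.+ z)) (ℕ.+-identityʳ m) ⟩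
  x * powℚ x (m ℕ.+ m)         ≡⟨ cong (x *_) (powℚ-+ x m m) ⟩
  x * (powℚ x m * powℚ x m)    ∎
  where open ≡-Reasoning

∈-↭-∷ : ∀ {A : Set} {x : A} {xs} → x ∈ xs → Σ (List A) λ rest → xs ↭ x ∷ rest
∈-↭-∷ {x = x} x∈xs with ∈-∃++ x∈xs
... | ys , zs , refl = ys ++ zs , ↭.shift x ys zs

allFin-↭-∷∷ : ∀ {n} (u v : Fin n) → ¬ u ≡ v → Σ (List (Fin n)) λ rest → allFin n ↭ u ∷ v ∷ rest
allFin-↭-∷∷ {n} u v u≢v with ∈-↭-∷ (∈-allFin u)
... | rest₁ , all↭u∷rest₁ with ↭.∈-resp-↭ all↭u∷rest₁ (∈-allFin v)
...   | here v≡u = ⊥-elim (u≢v (sym v≡u))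
...   | there v∈rest₁ with ∈-↭-∷ v∈rest₁
...     | rest , rest₁↭v∷rest = rest , ↭-trans all↭u∷rest₁ (↭-prep u rest₁↭v∷rest)

compAffine-t : ∀ a d → compAffine a d (0ℚ ∷ 1ℚ ∷ []) ≋ (a ∷ d ∷ [])
compAffine-t a d = ≋-trans (compAffine-linear a d 0ℚ 1ℚ) (≋-∷ (trans (+-identityˡ _) (*-identityˡ a)) (≋-∷ (*-identityˡ d) ≋-refl))

compAffine-linFactor : ∀ a d x → compAffine a d ((- x) ∷ 1ℚ ∷ []) ≋ ((a - x) ∷ d ∷ [])
compAffine-linFactor a d x = ≋-trans (compAffine-linear a d (- x) 1ℚ) (≋-∷ (linear a x) (≋-∷ (*-identityˡ d) ≋-refl))
  where
  linear : ∀ a x → - x + 1ℚ * a ≡ a - x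
  linear = solve-∀ ℚ-ring

compAffine-linFactor-pow : ∀ a d x m → compAffine a d (pow ((- x) ∷ 1ℚ ∷ []) m) ≋ pow ((a - x) ∷ d ∷ []) m
compAffine-linFactor-pow a d x m = ≋-trans (compAffine-pow a d _ m) (pow-cong m (compAffine-linFactor a d x))

-- After t = x_u + (x_v − x_u) s the integrand becomes (x_v − x_u)^{2m} times
--   (x_u + (x_v − x_u) s)^k · s^m · (s − 1)^m · ∏_{i ≠ u,v} (x_u − x_i + (x_v − x_u) s)^m,
-- whose integral over [0, 1] is the quotient.
module _ {n} (u v : Fin n) (k m : ℕ) (rest : List (Fin n)) (all↭ : allFin n ↭ u ∷ v ∷ rest) where

  rescaledIntegrand : TPoly n
  rescaledIntegrand =
    tmul (tpow (var u ∷ (var v ⊖ var u) ∷ []) k)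
         (tmul (tpow (con 0ℚ ∷ con 1ℚ ∷ []) m)
               (tmul (tpow (con (- 1ℚ) ∷ con 1ℚ ∷ []) m)
                     (tprod (map (λ i → tpow ((var u ⊖ var i) ∷ (var v ⊖ var u) ∷ []) m) rest))))

  quotient : Poly n
  quotient = integral (con 0ℚ) (con 1ℚ) rescaledIntegrand

  module _ (ρ : Fin n → ℚ) where

    private
      a d : ℚ
      a = ρ u
      d = ρ v - ρ u

    rescaledIntegrandAt : Poly₁
    rescaledIntegrandAt =
      mul (pow (a ∷ d ∷ []) k)
          (mul (pow (0ℚ ∷ 1ℚ ∷ []) m)
               (mul (pow ((- 1ℚ) ∷ 1ℚ ∷ []) m)
                    (prod (map (λ i → pow ((a - ρ i) ∷ d ∷ []) m) rest))))

    instantiate-rescaledIntegrand : instantiate ρ rescaledIntegrand ≡ rescaledIntegrandAt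
    instantiate-rescaledIntegrand =
      trans (instantiate-tmul ρ (tpow shifted k) _) (cong₂ mul (instantiate-tpow ρ shifted k)
      (trans (instantiate-tmul ρ (tpow s m) _) (cong₂ mul (instantiate-tpow ρ s m)
      (trans (instantiate-tmul ρ (tpow s-1 m) _) (cong₂ mul (instantiate-tpow ρ s-1 m)
      (trans (instantiate-tprod ρ (map factor rest)) (cong prod (trans (sym (map-∘ rest))
        (map-cong (λ i → instantiate-tpow ρ (linear i) m) rest)))))))))
      where
      shifted s s-1 : TPoly n
      shifted = var u ∷ (var v ⊖ var u) ∷ []
      s       = con 0ℚ ∷ con 1ℚ ∷ []
      s-1     = con (- 1ℚ) ∷ con 1ℚ ∷ []
      linear : Fin n → TPoly n
      linear i = (var u ⊖ var i) ∷ (var v ⊖ var u) ∷ []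
      factor : Fin n → TPoly n
      factor i = tpow (linear i) m

    compAffine-integrandAt : compAffine a d (integrandAt ρ k m) ≋ scale (powℚ d m * powℚ d m) rescaledIntegrandAt
    compAffine-integrandAt = begin
      compAffine a d (mul (pow t k) (prod (map factor (allFin n))))
        ≈⟨ compAffine-cong a d (mul-congʳ (pow t k) (prod-↭ (↭.map⁺ factor all↭))) ⟩
      compAffine a d (mul (pow t k) (mul (factor u) (mul (factor v) others)))
        ≈⟨ compAffine-mul a d (pow t k) _ ⟩
      mul (compAffine a d (pow t k)) (compAffine a d (mul (factor u) (mul (factor v) others)))
        ≈⟨ mul-congʳ (compAffine a d (pow t k))
                     (≋-trans (compAffine-mul a d (factor u) _) (mul-congʳ (compAffine a d (factor u)) (compAffine-mul a d (factor v) others))) ⟩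
      mul (compAffine a d (pow t k)) (mul (compAffine a d (factor u)) (mul (compAffine a d (factor v)) (compAffine a d others)))
        ≈⟨ mul-cong (≋-trans (compAffine-pow a d t k) (pow-cong k (compAffine-t a d)))
                    (mul-cong (rescale linFactor-u) (mul-cong (rescale linFactor-v) compAffine-rest)) ⟩
      mul A (mul (scale (powℚ d m) B) (mul (scale (powℚ d m) C) R))
        ≈⟨ mul-scale-scale A B C R (powℚ d m) ⟩
      scale (powℚ d m * powℚ d m) rescaledIntegrandAt
        ∎
      where
      open ≋-Reasoning
      t = 0ℚ ∷ 1ℚ ∷ []
      factor = λ i → pow ((- ρ i) ∷ 1ℚ ∷ []) m
      others = prod (map factor rest)
      A = pow (a ∷ d ∷ []) k
      B = pow (0ℚ ∷ 1ℚ ∷ []) m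
      C = pow ((- 1ℚ) ∷ 1ℚ ∷ []) m
      R = prod (map (λ i → pow ((a - ρ i) ∷ d ∷ []) m) rest)
      linFactor-u : ((a - a) ∷ d ∷ []) ≋ scale d (0ℚ ∷ 1ℚ ∷ [])
      linFactor-u = ≋-∷ (trans (+-inverseʳ a) (sym (*-zeroʳ d))) (≋-∷ (sym (*-identityʳ d)) ≋-refl)
      linFactor-v : ((a - ρ v) ∷ d ∷ []) ≋ scale d ((- 1ℚ) ∷ 1ℚ ∷ [])
      linFactor-v = ≋-∷ (negate (ρ u) (ρ v)) (≋-∷ (sym (*-identityʳ d)) ≋-refl)
        where
        negate : ∀ x y → x - y ≡ (y - x) * (- 1ℚ)
        negate = solve-∀ ℚ-ring
      rescale : ∀ {i c} → ((a - ρ i) ∷ d ∷ []) ≋ scale d c → compAffine a d (factor i) ≋ scale (powℚ d m) (pow c m)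
      rescale {i} {c} h = ≋-trans (compAffine-linFactor-pow a d (ρ i) m) (≋-trans (pow-cong m h) (scale-pow d c m))
      compAffine-rest : compAffine a d others ≋ R
      compAffine-rest = ≋-trans (compAffine-prod a d (map factor rest))
        (subst (λ fs → prod fs ≋ R) (map-∘ rest)
          (prod-map-cong rest (λ i → compAffine-linFactor-pow a d (ρ i) m)))

    sem-quotient : ⟦ quotient ⟧ ρ ≡ eval (anti rescaledIntegrandAt) 1ℚ
    sem-quotient = begin
      ⟦ quotient ⟧ ρ                                             ≡⟨ sem-integral ρ (con 0ℚ) (con 1ℚ) rescaledIntegrand ⟩
      I (instantiate ρ rescaledIntegrand) 1ℚ - I (instantiate ρ rescaledIntegrand) 0ℚ
        ≡⟨ cong (λ f → I f 1ℚ - I f 0ℚ) instantiate-rescaledIntegrand ⟩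
      I rescaledIntegrandAt 1ℚ - I rescaledIntegrandAt 0ℚ        ≡⟨ cong (λ z → I rescaledIntegrandAt 1ℚ - z) (eval-anti-0 rescaledIntegrandAt) ⟩
      I rescaledIntegrandAt 1ℚ - 0ℚ                              ≡⟨ +-identityʳ _ ⟩
      I rescaledIntegrandAt 1ℚ                                   ∎
      where
      open ≡-Reasoning
      I = λ f → eval (anti f)

    Φ-difference : Φ ρ k m (ρ v) - Φ ρ k m (ρ u) ≡ powℚ (ρ v - ρ u) (2 ℕ.* m ℕ.+ 1) * ⟦ quotient ⟧ ρ
    Φ-difference = begin
      Φ ρ k m (ρ v) - Φ ρ k m a
        ≡⟨ cong (λ x → Φ ρ k m x - Φ ρ k m a) (endpoint (ρ v) (ρ u)) ⟩
      Φ ρ k m (a + d * 1ℚ) - Φ ρ k m a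
        ≡⟨ cong (_- Φ ρ k m a) (eval-anti-affine a d (integrandAt ρ k m) 1ℚ) ⟩
      (Φ ρ k m a + d * eval (anti (compAffine a d (integrandAt ρ k m))) 1ℚ) - Φ ρ k m a
        ≡⟨ cong (λ z → (Φ ρ k m a + d * z) - Φ ρ k m a)
                (trans (eval-cong 1ℚ (≋-trans (anti-cong compAffine-integrandAt) (anti-scale (powℚ d m * powℚ d m) rescaledIntegrandAt)))
                       (eval-scale (powℚ d m * powℚ d m) (anti rescaledIntegrandAt) 1ℚ)) ⟩
      (Φ ρ k m a + d * ((powℚ d m * powℚ d m) * eval (anti rescaledIntegrandAt) 1ℚ)) - Φ ρ k m a
        ≡⟨ cancel (Φ ρ k m a) d (powℚ d m) _ ⟩
      (d * (powℚ d m * powℚ d m)) * eval (anti rescaledIntegrandAt) 1ℚ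
        ≡⟨ cong₂ _*_ (powℚ-2m+1 d m) sem-quotient ⟨
      powℚ d (2 ℕ.* m ℕ.+ 1) * ⟦ quotient ⟧ ρ
        ∎
      where
      open ≡-Reasoning
      endpoint : ∀ x y → x ≡ y + (x - y) * 1ℚ
      endpoint = solve-∀ ℚ-ring
      cancel : ∀ h d p e → (h + d * ((p * p) * e)) - h ≡ (d * (p * p)) * e
      cancel = solve-∀ ℚ-ring

Φ-difference-divisible : ∀ {n} (u v : Fin n) → ¬ u ≡ v → (k m : ℕ) →
  Σ (Poly n) λ g → ∀ ρ → Φ ρ k m (ρ v) - Φ ρ k m (ρ u) ≡ powℚ (ρ v - ρ u) (2 ℕ.* m ℕ.+ 1) * ⟦ g ⟧ ρ
Φ-difference-divisible u v u≢v k m with allFin-↭-∷∷ u v u≢v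
... | rest , all↭ = quotient u v k m rest all↭ , Φ-difference u v k m rest all↭

-- Sums over arrangements

fromℕ-+ : ∀ a b → fromℕ (a ℕ.+ b) ≡ fromℕ a + fromℕ b
fromℕ-+ = ×-homo-+ 1ℚ

fromℕ-* : ∀ a b → fromℕ (a ℕ.* b) ≡ fromℕ a * fromℕ b
fromℕ-* = ×1-homo-*

sumℚ : List ℚ → ℚ
sumℚ = foldr _+_ 0ℚ

module _ {A : Set} where

  sumℚ-const : ∀ (xs : List A) c → sumℚ (map (λ _ → c) xs) ≡ fromℕ (length xs) * c
  sumℚ-const []       c = sym (*-zeroˡ c)
  sumℚ-const (x ∷ xs) c = trans (cong (c +_) (sumℚ-const xs c)) (distrib c (fromℕ (length xs)))
    where
    distrib : ∀ c n → c + n * c ≡ (1ℚ + n) * c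
    distrib = solve-∀ ℚ-ring

  sumℚ-cong : ∀ {f g : A → ℚ} (xs : List A) → All (λ x → f x ≡ g x) xs → sumℚ (map f xs) ≡ sumℚ (map g xs)
  sumℚ-cong []       []       = refl
  sumℚ-cong (x ∷ xs) (e ∷ es) = cong₂ _+_ e (sumℚ-cong xs es)

  sumℚ-+ : ∀ (f g : A → ℚ) xs → sumℚ (map (λ x → f x + g x) xs) ≡ sumℚ (map f xs) + sumℚ (map g xs)
  sumℚ-+ f g []       = sym (+-identityˡ 0ℚ)
  sumℚ-+ f g (x ∷ xs) =
    trans (cong (f x + g x +_) (sumℚ-+ f g xs)) (interchange (f x) (g x) (sumℚ (map f xs)) (sumℚ (map g xs)))
    where
    interchange : ∀ a b c d → (a + b) + (c + d) ≡ (a + c) + (b + d)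
    interchange = solve-∀ ℚ-ring

  sumℚ-- : ∀ (f g : A → ℚ) xs → sumℚ (map (λ x → f x - g x) xs) ≡ sumℚ (map f xs) - sumℚ (map g xs)
  sumℚ-- f g []       = refl
  sumℚ-- f g (x ∷ xs) =
    trans (cong (f x - g x +_) (sumℚ-- f g xs)) (interchange (f x) (g x) (sumℚ (map f xs)) (sumℚ (map g xs)))
    where
    interchange : ∀ a b c d → (a - b) + (c - d) ≡ (a + c) - (b + d)
    interchange = solve-∀ ℚ-ring

  sumℚ-*ˡ : ∀ c (f : A → ℚ) xs → sumℚ (map (λ x → c * f x) xs) ≡ c * sumℚ (map f xs)
  sumℚ-*ˡ c f []       = sym (*-zeroʳ c)
  sumℚ-*ˡ c f (x ∷ xs) = trans (cong (c * f x +_) (sumℚ-*ˡ c f xs)) (sym (*-distribˡ-+ c (f x) _))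

  sumℚ-++ : ∀ xs ys → sumℚ (xs ++ ys) ≡ sumℚ xs + sumℚ ys
  sumℚ-++ []       ys = sym (+-identityˡ _)
  sumℚ-++ (x ∷ xs) ys = trans (cong (x +_) (sumℚ-++ xs ys)) (sym (+-assoc x (sumℚ xs) (sumℚ ys)))

  sumℚ-concatMap : ∀ {B : Set} (f : A → ℚ) (g : B → List A) ys →
    sumℚ (map f (concatMap g ys)) ≡ sumℚ (map (λ y → sumℚ (map f (g y))) ys)
  sumℚ-concatMap f g []       = refl
  sumℚ-concatMap f g (y ∷ ys) = trans (cong sumℚ (map-++ f (g y) (concatMap g ys)))
    (trans (sumℚ-++ (map f (g y)) (map f (concatMap g ys))) (cong (sumℚ (map f (g y)) +_) (sumℚ-concatMap f g ys)))

module _ {A : Set} where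

  headOr : A → List A → A
  headOr d []      = d
  headOr d (x ∷ _) = x

  length-insertions : ∀ x (ys : List A) → length (insertions x ys) ≡ suc (length ys)
  length-insertions x []       = refl
  length-insertions x (y ∷ ys) = cong suc (trans (length-map (y ∷_) (insertions x ys)) (length-insertions x ys))

  insertions-↭ : ∀ x (ys : List A) → All (_↭ x ∷ ys) (insertions x ys)
  insertions-↭ x []       = ↭-refl ∷ []
  insertions-↭ x (y ∷ ys) = ↭-refl ∷ All.map⁺ {P = _↭ x ∷ y ∷ ys} {f = y ∷_} (All.map (λ p → ↭-trans (↭-prep y p) (↭-swap y x ↭-refl)) (insertions-↭ x ys))

  arrangements-↭ : ∀ (U : List A) → All (_↭ U) (arrangements U)
  arrangements-↭ []       = ↭-refl ∷ []
  arrangements-↭ (x ∷ xs) = All.concat⁺ (All.map⁺ {P = All (_↭ x ∷ xs)} {f = insertions x} (All.map (λ {π} π↭xs → All.map (λ q → ↭-trans q (↭-prep x π↭xs)) (insertions-↭ x π)) (arrangements-↭ xs)))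

  sumℚ-arrangements-const : ∀ (U : List A) c → sumℚ (map (λ _ → c) (arrangements U)) ≡ fromℕ (length U !) * c
  sumℚ-arrangements-const []       c = trans (+-identityʳ c) (sym (*-identityˡ c))
  sumℚ-arrangements-const (x ∷ xs) c = begin
    sumℚ (map (λ _ → c) (concatMap (insertions x) (arrangements xs)))
      ≡⟨ sumℚ-concatMap (λ _ → c) (insertions x) (arrangements xs) ⟩
    sumℚ (map (λ π → sumℚ (map (λ _ → c) (insertions x π))) (arrangements xs))
      ≡⟨ sumℚ-cong (arrangements xs) (All.map (λ {π} π↭xs → trans (sumℚ-const (insertions x π) c)
                    (cong (λ l → fromℕ l * c) (trans (length-insertions x π) (cong suc (↭.↭-length π↭xs))))) (arrangements-↭ xs)) ⟩
    sumℚ (map (λ _ → fromℕ (suc (length xs)) * c) (arrangements xs))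
      ≡⟨ sumℚ-*ˡ (fromℕ (suc (length xs))) (λ _ → c) (arrangements xs) ⟩
    fromℕ (suc (length xs)) * sumℚ (map (λ _ → c) (arrangements xs))
      ≡⟨ cong (fromℕ (suc (length xs)) *_) (sumℚ-arrangements-const xs c) ⟩
    fromℕ (suc (length xs)) * (fromℕ (length xs !) * c)
      ≡⟨ *-assoc (fromℕ (suc (length xs))) (fromℕ (length xs !)) c ⟨
    (fromℕ (suc (length xs)) * fromℕ (length xs !)) * c
      ≡⟨ cong (_* c) (fromℕ-* (suc (length xs)) (length xs !)) ⟨
    fromℕ (suc (length xs) ℕ.* length xs !) * c
      ∎
    where open ≡-Reasoning

  sumℚ-insertions-head : ∀ (g : A → ℚ) x ys → sumℚ (map (g ∘ headOr x) (insertions x ys)) ≡ g x + fromℕ (length ys) * g (headOr x ys)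
  sumℚ-insertions-head g x []       = cong (g x +_) (sym (*-zeroˡ (g x)))
  sumℚ-insertions-head g x (y ∷ ys) = cong (g x +_) (trans (cong sumℚ (sym (map-∘ (insertions x ys))))
    (trans (sumℚ-const (insertions x ys) (g y)) (cong (λ l → fromℕ l * g y) (length-insertions x ys))))

  headOr-↭-∷ : ∀ x y (π ys : List A) → π ↭ y ∷ ys → headOr x π ≡ headOr y π
  headOr-↭-∷ x y []      ys π↭ with () ← ↭.↭-empty-inv (↭-sym π↭)
  headOr-↭-∷ x y (z ∷ π) ys π↭ = refl

  -- Each x ∈ U heads (|U| − 1)! arrangements of U.
  sumℚ-arrangements-head : ∀ (g : A → ℚ) x V →
    sumℚ (map (g ∘ headOr x) (arrangements (x ∷ V))) ≡ fromℕ (length V !) * sumℚ (map g (x ∷ V))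
  sumℚ-arrangements-head g x []       = sym (trans (cong (_* (g x + 0ℚ)) (+-identityʳ 1ℚ)) (*-identityˡ (g x + 0ℚ)))
  sumℚ-arrangements-head g x (y ∷ V′) = begin
    sumℚ (map (g ∘ headOr x) (concatMap (insertions x) (arrangements V)))
      ≡⟨ sumℚ-concatMap (g ∘ headOr x) (insertions x) (arrangements V) ⟩
    sumℚ (map (λ π → sumℚ (map (g ∘ headOr x) (insertions x π))) (arrangements V))
      ≡⟨ sumℚ-cong (arrangements V) (All.map (λ {π} π↭V → trans (sumℚ-insertions-head g x π)
                    (cong₂ (λ l w → g x + fromℕ l * g w) (↭.↭-length π↭V) (headOr-↭-∷ x y π V′ π↭V))) (arrangements-↭ V)) ⟩
    sumℚ (map (λ π → g x + fromℕ |V| * g (headOr y π)) (arrangements V))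
      ≡⟨ sumℚ-+ (λ _ → g x) (λ π → fromℕ |V| * g (headOr y π)) (arrangements V) ⟩
    sumℚ (map (λ _ → g x) (arrangements V)) + sumℚ (map (λ π → fromℕ |V| * g (headOr y π)) (arrangements V))
      ≡⟨ cong₂ _+_ (sumℚ-arrangements-const V (g x)) (sumℚ-*ˡ (fromℕ |V|) (g ∘ headOr y) (arrangements V)) ⟩
    fromℕ (|V| !) * g x + fromℕ |V| * sumℚ (map (g ∘ headOr y) (arrangements V))
      ≡⟨ cong (λ z → fromℕ (|V| !) * g x + fromℕ |V| * z) (sumℚ-arrangements-head g y V′) ⟩
    fromℕ (|V| !) * g x + fromℕ |V| * (fromℕ (length V′ !) * sumℚ (map g V))
      ≡⟨ cong (λ z → fromℕ (|V| !) * g x + z)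
              (trans (sym (*-assoc (fromℕ |V|) _ _)) (cong (_* sumℚ (map g V)) (sym (fromℕ-* |V| (length V′ !))))) ⟩
    fromℕ (|V| !) * g x + fromℕ (|V| !) * sumℚ (map g V)
      ≡⟨ *-distribˡ-+ (fromℕ (|V| !)) (g x) (sumℚ (map g V)) ⟨
    fromℕ (|V| !) * sumℚ (map g (x ∷ V))
      ∎
    where
    open ≡-Reasoning
    V = y ∷ V′
    |V| = length V

-- Signs

𝟙 : Bool → ℕ
𝟙 true  = 1
𝟙 false = 0

𝟙-yes : ∀ {P : Set} (P? : Dec P) → P → 𝟙 (does P?) ≡ 1
𝟙-yes (yes _) p = refl
𝟙-yes (no ¬p) p = ⊥-elim (¬p p)

𝟙-no : ∀ {P : Set} (P? : Dec P) → ¬ P → 𝟙 (does P?) ≡ 0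
𝟙-no (yes p) ¬p = ⊥-elim (¬p p)
𝟙-no (no _)  ¬p = refl

length-filter-filter : ∀ {A : Set} {P Q : A → Set} (P? : ∀ x → Dec (P x)) (Q? : ∀ x → Dec (Q x)) xs →
  length (filter Q? (filter P? xs)) ≡ sum (map (λ x → 𝟙 (does (P? x)) ℕ.* 𝟙 (does (Q? x))) xs)
length-filter-filter P? Q? []       = refl
length-filter-filter P? Q? (x ∷ xs) with does (P? x)
... | false = length-filter-filter P? Q? xs
... | true with does (Q? x)
...   | false = length-filter-filter P? Q? xs
...   | true  = cong suc (length-filter-filter P? Q? xs)

sum-concatMap : ∀ {A B : Set} (f : A → ℕ) (g : B → List A) ys →
  sum (map f (concatMap g ys)) ≡ sum (map (λ y → sum (map f (g y))) ys)
sum-concatMap f g []       = refl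
sum-concatMap f g (y ∷ ys) = trans (cong sum (map-++ f (g y) (concatMap g ys)))
  (trans (sum-++ (map f (g y)) _) (cong (sum (map f (g y)) ℕ.+_) (sum-concatMap f g ys)))

sumFin : ∀ n → (Fin n → ℕ) → ℕ
sumFin n f = sum (tabulate f)

sumFin-cong : ∀ n {f g : Fin n → ℕ} → (∀ x → f x ≡ g x) → sumFin n f ≡ sumFin n g
sumFin-cong zero    h = refl
sumFin-cong (suc n) h = cong₂ ℕ._+_ (h Fin.zero) (sumFin-cong n (h ∘ Fin.suc))

sumFin-0 : ∀ n → sumFin n (λ _ → 0) ≡ 0
sumFin-0 zero    = refl
sumFin-0 (suc n) = sumFin-0 n

sumFin-*ʳ : ∀ n (f : Fin n → ℕ) c → sumFin n (λ x → f x ℕ.* c) ≡ sumFin n f ℕ.* c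
sumFin-*ʳ zero    f c = refl
sumFin-*ʳ (suc n) f c =
  trans (cong (f Fin.zero ℕ.* c ℕ.+_) (sumFin-*ʳ n (f ∘ Fin.suc) c)) (sym (ℕ.*-distribʳ-+ c (f Fin.zero) _))

sumFin-≡ : ∀ n (j : Fin n) → sumFin n (λ b → 𝟙 (does (b ≟ j))) ≡ 1
sumFin-≡ (suc n) Fin.zero    = cong suc (sumFin-0 n)
sumFin-≡ (suc n) (Fin.suc j) = sumFin-≡ n j

sumFin-< : ∀ n (j : Fin n) → sumFin n (λ b → 𝟙 (does (b Fin.<? j))) ≡ toℕ j
sumFin-< (suc n) Fin.zero    = sumFin-0 n
sumFin-< (suc n) (Fin.suc j) = cong suc (sumFin-< n j)

sumFin-≤ : ∀ n (j : Fin n) → sumFin n (λ b → 𝟙 (does (b Fin.<? Fin.suc j))) ≡ suc (toℕ j)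
sumFin-≤ (suc n) Fin.zero    = cong suc (sumFin-0 n)
sumFin-≤ (suc n) (Fin.suc j) = cong suc (sumFin-≤ n j)

inversion : ∀ {n} → Perm n → Fin n → Fin n → ℕ
inversion σ a b = 𝟙 (does (a Fin.<? b)) ℕ.* 𝟙 (does (σ b Fin.<? σ a))

inversions≡sumFin : ∀ {n} (σ : Perm n) → inversions σ ≡ sumFin n (λ a → sumFin n (inversion σ a))
inversions≡sumFin {n} σ =
  trans (length-filter-filter (λ ab → proj₁ ab Fin.<? proj₂ ab) (λ ab → σ (proj₂ ab) Fin.<? σ (proj₁ ab)) pairs)
  (trans (sum-concatMap inv (λ a → map (a ,_) (allFin n)) (allFin n))
  (trans (cong sum (map-cong (λ a → cong sum (trans (sym (map-∘ (allFin n))) (map-tabulate id (λ b → inv (a , b))))) (allFin n)))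
         (cong sum (map-tabulate id (λ a → sumFin n (λ b → inv (a , b)))))))
  where
  pairs = concatMap (λ a → map (a ,_) (allFin n)) (allFin n)
  inv   = λ (ab : Fin n × Fin n) → inversion σ (proj₁ ab) (proj₂ ab)

inversion-id : ∀ {n} (a b : Fin n) → inversion id a b ≡ 0
inversion-id a b = asymmetric (a Fin.<? b) (b Fin.<? a)
  where
  asymmetric : (a<?b : Dec (a Fin.< b)) (b<?a : Dec (b Fin.< a)) → 𝟙 (does a<?b) ℕ.* 𝟙 (does b<?a) ≡ 0
  asymmetric (yes a<b) (yes b<a) = ⊥-elim (Fin.<-asym a<b b<a)
  asymmetric (yes _)   (no _)    = refl
  asymmetric (no _)    _         = refl

sgn-id : ∀ {n} (σ : Perm n) → (∀ x → σ x ≡ x) → sgn σ ≡ 1ℚ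
sgn-id {n} σ σ≗id = cong sgnℚ (begin
  inversions σ                                     ≡⟨ inversions≡sumFin σ ⟩
  sumFin n (λ a → sumFin n (inversion σ a))        ≡⟨ sumFin-cong n (λ a → sumFin-cong n (λ b → cong₂ (λ x y → 𝟙 (does (a Fin.<? b)) ℕ.* 𝟙 (does (x Fin.<? y))) (σ≗id b) (σ≗id a))) ⟩
  sumFin n (λ a → sumFin n (inversion id a))       ≡⟨ sumFin-cong n (λ a → trans (sumFin-cong n (inversion-id a)) (sumFin-0 n)) ⟩
  sumFin n (λ _ → 0)                               ≡⟨ sumFin-0 n ⟩
  0                                                ∎)
  where open ≡-Reasoning

sgnℚ-odd : ∀ k → sgnℚ (suc (k ℕ.+ k)) ≡ - 1ℚ
sgnℚ-odd zero    = refl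
sgnℚ-odd (suc k) = trans (cong (λ i → sgnℚ (suc (suc i))) (ℕ.+-suc k k)) (sgnℚ-odd k)

<-suc-≢ : ∀ {n} (b j : Fin n) → ¬ b ≡ j → 𝟙 (does (b Fin.<? j)) ≡ 𝟙 (does (b Fin.<? Fin.suc j))
<-suc-≢ b j b≢j = agree (b Fin.<? j) (b Fin.<? Fin.suc j)
  where
  agree : (b<?j : Dec (b Fin.< j)) (b≤?j : Dec (b Fin.< Fin.suc j)) → 𝟙 (does b<?j) ≡ 𝟙 (does b≤?j)
  agree (yes _)   (yes _)   = refl
  agree (yes b<j) (no ¬b≤j) = ⊥-elim (¬b≤j (ℕ.m≤n⇒m≤1+n b<j))
  agree (no ¬b<j) (yes b≤j) = ⊥-elim (¬b<j (ℕ.≤∧≢⇒< (ℕ.≤-pred b≤j) (b≢j ∘ Fin.toℕ-injective)))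
  agree (no _)    (no _)    = refl

-- The inversions of the transposition (0 j+1) are the pairs (0, b) with b ≤ j+1 and the
-- pairs (a, j+1) with 0 < a ≤ j.
module _ {n : ℕ} (j : Fin n) (σ : Perm (suc n))
  (σ0 : σ Fin.zero ≡ Fin.suc j) (σj : σ (Fin.suc j) ≡ Fin.zero)
  (σ-fix : ∀ x → ¬ x ≡ j → σ (Fin.suc x) ≡ Fin.suc x) where

  private
    inversions-from-0 : ∀ b → inversion σ Fin.zero (Fin.suc b) ≡ 𝟙 (does (b Fin.<? Fin.suc j))
    inversions-from-0 b with b ≟ j
    ... | yes refl rewrite σ0 | σj = sym (𝟙-yes (b Fin.<? Fin.suc b) ℕ.≤-refl)
    ... | no b≢j rewrite σ0 | σ-fix b b≢j = trans (ℕ.+-identityʳ _) (<-suc-≢ b j b≢j)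

    inversions-from-j : ∀ b → inversion σ (Fin.suc j) b ≡ 0
    inversions-from-j b rewrite σj = ℕ.*-zeroʳ (𝟙 (does (Fin.suc j Fin.<? b)))

    inversions-from-other : ∀ a → ¬ a ≡ j → ∀ b → inversion σ (Fin.suc a) (Fin.suc b) ≡ 𝟙 (does (b ≟ j)) ℕ.* 𝟙 (does (a Fin.<? j))
    inversions-from-other a a≢j b with b ≟ j
    ... | yes refl rewrite σj | σ-fix a a≢j =
      trans (cong (𝟙 (does (a Fin.<? b)) ℕ.*_) (𝟙-yes (Fin.zero {n} Fin.<? Fin.suc a) (s≤s z≤n)))
            (trans (ℕ.*-identityʳ _) (sym (ℕ.+-identityʳ _)))
    ... | no b≢j rewrite σ-fix a a≢j | σ-fix b b≢j = inversion-id a b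

    inversions-from-suc : ∀ a → sumFin (suc n) (inversion σ (Fin.suc a)) ≡ 𝟙 (does (a Fin.<? j))
    inversions-from-suc a with a ≟ j
    ... | yes refl = trans (sumFin-cong (suc n) inversions-from-j)
                           (trans (sumFin-0 (suc n)) (sym (𝟙-no (a Fin.<? a) (Fin.<-irrefl refl))))
    ... | no a≢j = trans (sumFin-cong n (inversions-from-other a a≢j))
                   (trans (sumFin-*ʳ n (λ b → 𝟙 (does (b ≟ j))) _)
                   (trans (cong (ℕ._* 𝟙 (does (a Fin.<? j))) (sumFin-≡ n j)) (ℕ.+-identityʳ _)))

  inversions-transposition₀ : inversions σ ≡ suc (toℕ j ℕ.+ toℕ j)
  inversions-transposition₀ =
    trans (inversions≡sumFin σ)
          (trans (cong₂ ℕ._+_ (sumFin-cong n inversions-from-0) (sumFin-cong n inversions-from-suc))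
                 (cong₂ ℕ._+_ (sumFin-≤ n j) (sumFin-< n j)))

  sgn-transposition₀ : sgn σ ≡ - 1ℚ
  sgn-transposition₀ = trans (cong sgnℚ inversions-transposition₀) (sgnℚ-odd (toℕ j))

-- Arrangements as permutations; transpositions

module _ {n : ℕ} where

  fromArr-∉ : ∀ (U π : List (Fin n)) x → All (λ u → ¬ x ≡ u) U → fromArr U π x ≡ x
  fromArr-∉ []       π        x h          = refl
  fromArr-∉ (u ∷ us) []       x h          = refl
  fromArr-∉ (u ∷ us) (v ∷ vs) x (x≢u ∷ h) with x ≟ u
  ... | yes x≡u = ⊥-elim (x≢u x≡u)
  ... | no _    = fromArr-∉ us vs x h

  fromArr-head : ∀ (u : Fin n) us v vs → fromArr (u ∷ us) (v ∷ vs) u ≡ v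
  fromArr-head u us v vs with u ≟ u
  ... | yes _ = refl
  ... | no u≢u = ⊥-elim (u≢u refl)

  fromArr-skip : ∀ (u : Fin n) us v vs x → ¬ x ≡ u → fromArr (u ∷ us) (v ∷ vs) x ≡ fromArr us vs x
  fromArr-skip u us v vs x x≢u with x ≟ u
  ... | yes x≡u = ⊥-elim (x≢u x≡u)
  ... | no _    = refl

  fromArr-[c] : ∀ (c x : Fin n) → fromArr (c ∷ []) (c ∷ []) x ≡ x
  fromArr-[c] c x with x ≟ c
  ... | yes x≡c = sym x≡c
  ... | no _    = refl

  map-fromArr : ∀ (U π : List (Fin n)) → Unique U → length π ≡ length U → map (fromArr U π) U ≡ π
  map-fromArr []       []       _            _   = refl
  map-fromArr (u ∷ us) (v ∷ vs) (u∉us ∷ !us) len =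
    cong₂ _∷_ (fromArr-head u us v vs)
      (trans (map-cong-local (All.map (λ {x} u≢x → fromArr-skip u us v vs x (u≢x ∘ sym)) u∉us))
             (map-fromArr us vs !us (ℕ.suc-injective len)))

  transp-left : ∀ (a b : Fin n) → transp a b a ≡ b
  transp-left a b with a ≟ a
  ... | yes _   = refl
  ... | no a≢a = ⊥-elim (a≢a refl)

  transp-right : ∀ (a b : Fin n) → transp a b b ≡ a
  transp-right a b with b ≟ a | b ≟ b
  ... | yes b≡a | _       = b≡a
  ... | no _    | yes _   = refl
  ... | no _    | no b≢b = ⊥-elim (b≢b refl)

  transp-other : ∀ (a b x : Fin n) → ¬ x ≡ a → ¬ x ≡ b → transp a b x ≡ x
  transp-other a b x x≢a x≢b with x ≟ a | x ≟ b
  ... | yes x≡a | _       = ⊥-elim (x≢a x≡a)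
  ... | no _    | yes x≡b = ⊥-elim (x≢b x≡b)
  ... | no _    | no _    = refl

  transp-involutive : ∀ (a b x : Fin n) → transp a b (transp a b x) ≡ x
  transp-involutive a b x with x ≟ a | x ≟ b
  ... | yes refl | _        = transp-right x b
  ... | no _     | yes refl = transp-left a x
  ... | no x≢a   | no x≢b   = transp-other a b x x≢a x≢b

  inverse⇒IsPermutation : ∀ (σ σ⁻¹ : Perm n) → (∀ x → σ⁻¹ (σ x) ≡ x) → (∀ x → σ (σ⁻¹ x) ≡ x) → IsPermutation σ
  inverse⇒IsPermutation σ σ⁻¹ left right = ∼bag⇒↭ (unique∧set⇒bag
    (Unique.map⁺ (λ {x} {y} σx≡σy → trans (sym (left x)) (trans (cong σ⁻¹ σx≡σy) (left y))) (Unique.allFin⁺ n))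
    (Unique.allFin⁺ n)
    (λ {x} → mk⇔ (λ _ → ∈-allFin x) (λ _ → subst (_∈ map σ (allFin n)) (right x) (∈-map⁺ σ (∈-allFin (σ⁻¹ x))))))

  transp-IsPermutation : ∀ (a b : Fin n) → IsPermutation (transp a b)
  transp-IsPermutation a b = inverse⇒IsPermutation (transp a b) (transp a b) (transp-involutive a b) (transp-involutive a b)

  ↭allFin⇒Unique : ∀ {xs : List (Fin n)} → xs ↭ allFin n → Unique xs
  ↭allFin⇒Unique xs↭ = ↭ₛ.Unique-resp-↭ (setoid (Fin n)) (↭⇒↭ₛ (↭-sym xs↭)) (Unique.allFin⁺ n)

-- Quasi-invariance

powℚ-neg-square : ∀ x m → powℚ (- x) m * powℚ (- x) m ≡ powℚ x m * powℚ x m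
powℚ-neg-square x zero    = refl
powℚ-neg-square x (suc m) =
  trans (square (- x) (powℚ (- x) m)) (trans (cong ((- x) * (- x) *_) (powℚ-neg-square x m)) (sym (neg-square x (powℚ x m))))
  where
  square : ∀ y A → (y * A) * (y * A) ≡ y * y * (A * A)
  square = solve-∀ ℚ-ring
  neg-square : ∀ y B → (y * B) * (y * B) ≡ (- y) * (- y) * (B * B)
  neg-square = solve-∀ ℚ-ring

powℚ-neg-2m+1 : ∀ x m → powℚ (- x) (2 ℕ.* m ℕ.+ 1) ≡ - powℚ x (2 ℕ.* m ℕ.+ 1)
powℚ-neg-2m+1 x m = begin
  powℚ (- x) (2 ℕ.* m ℕ.+ 1)            ≡⟨ powℚ-2m+1 (- x) m ⟩
  (- x) * (powℚ (- x) m * powℚ (- x) m) ≡⟨ cong ((- x) *_) (powℚ-neg-square x m) ⟩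
  (- x) * (powℚ x m * powℚ x m)         ≡⟨ neg-* x (powℚ x m * powℚ x m) ⟩
  - (x * (powℚ x m * powℚ x m))         ≡⟨ cong -_ (powℚ-2m+1 x m) ⟨
  - powℚ x (2 ℕ.* m ℕ.+ 1)              ∎
  where
  open ≡-Reasoning
  neg-* : ∀ x y → (- x) * y ≡ - (x * y)
  neg-* = solve-∀ ℚ-ring

transp-multiplicity : ∀ {n} → Fin n → Fin n → Fin n → ℚ
transp-multiplicity a b x with x ≟ a | x ≟ b
... | yes _ | _     = - 1ℚ
... | no _  | yes _ = 1ℚ
... | no _  | no _  = 0ℚ

sub-transp : ∀ {n} (a b : Fin n) (h : Fin n → ℚ) x → h x - h (transp a b x) ≡ transp-multiplicity a b x * (h b - h a)
sub-transp a b h x with x ≟ a | x ≟ b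
... | yes refl | _        = flip (h x) (h b)
  where
  flip : ∀ u v → u - v ≡ (- 1ℚ) * (v - u)
  flip = solve-∀ ℚ-ring
... | no _     | yes refl = sym (*-identityˡ (h x - h a))
... | no _     | no _     = trans (+-inverseʳ (h x)) (sym (*-zeroˡ (h b - h a)))

Φ-difference-quasiInvariant : ∀ {n} (k m : ℕ) (z j : Fin n) (P : Poly n) →
  (∀ ρ → ⟦ P ⟧ ρ ≡ Φ ρ k m (ρ j) - Φ ρ k m (ρ z)) → QI m P
Φ-difference-quasiInvariant k m z j P ⟦P⟧ a b a≢b = con (ε z - ε j) ⊗ g , λ ρ → begin
  ⟦ P ⟧ ρ - ⟦ act τ P ⟧ ρ
    ≡⟨ cong₂ _-_ (⟦P⟧ ρ) (trans (sem-act τ P ρ) (⟦P⟧ (ρ ∘ τ))) ⟩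
  (h ρ j - h ρ z) - (Φ (ρ ∘ τ) k m (ρ (τ j)) - Φ (ρ ∘ τ) k m (ρ (τ z)))
    ≡⟨ cong₂ (λ u v → (h ρ j - h ρ z) - (u - v)) (Φ-∘ ρ k m τ-perm (ρ (τ j))) (Φ-∘ ρ k m τ-perm (ρ (τ z))) ⟩
  (h ρ j - h ρ z) - (h ρ (τ j) - h ρ (τ z))
    ≡⟨ regroup (h ρ j) (h ρ z) (h ρ (τ j)) (h ρ (τ z)) ⟩
  (h ρ j - h ρ (τ j)) - (h ρ z - h ρ (τ z))
    ≡⟨ cong₂ _-_ (sub-transp a b (h ρ) j) (sub-transp a b (h ρ) z) ⟩
  ε j * (h ρ b - h ρ a) - ε z * (h ρ b - h ρ a)
    ≡⟨ cong (λ D → ε j * D - ε z * D) (⟦g⟧ ρ) ⟩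
  ε j * (powℚ (ρ b - ρ a) e * ⟦ g ⟧ ρ) - ε z * (powℚ (ρ b - ρ a) e * ⟦ g ⟧ ρ)
    ≡⟨ factor (ε j) (ε z) (powℚ (ρ b - ρ a) e) (⟦ g ⟧ ρ) ⟩
  (- powℚ (ρ b - ρ a) e) * ((ε z - ε j) * ⟦ g ⟧ ρ)
    ≡⟨ cong (_* ((ε z - ε j) * ⟦ g ⟧ ρ)) (trans (sym (powℚ-neg-2m+1 (ρ b - ρ a) m))
                                             (trans (cong (λ x → powℚ x e) (neg-sub (ρ b) (ρ a))) (sym (sem-^ (var a ⊖ var b) e ρ)))) ⟩
  ⟦ (var a ⊖ var b) ^ e ⟧ ρ * ((ε z - ε j) * ⟦ g ⟧ ρ)
    ∎
  where
  open ≡-Reasoning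
  g   = proj₁ (Φ-difference-divisible a b a≢b k m)
  ⟦g⟧ = proj₂ (Φ-difference-divisible a b a≢b k m)
  e = 2 ℕ.* m ℕ.+ 1
  τ = transp a b
  τ-perm = transp-IsPermutation a b
  ε = transp-multiplicity a b
  h = λ ρ x → Φ ρ k m (ρ x)
  regroup : ∀ a b c d → (a - b) - (c - d) ≡ (a - c) - (b - d)
  regroup = solve-∀ ℚ-ring
  factor : ∀ cj cz P G → cj * (P * G) - cz * (P * G) ≡ (- P) * ((cz - cj) * G)
  factor = solve-∀ ℚ-ring
  neg-sub : ∀ x y → - (x - y) ≡ y - x
  neg-sub = solve-∀ ℚ-ring

-- The Young symmetriser γ_T

-- For n = r + 2: (n − 1)/n! · ((n − 1)! + (n − 2)!) = 1, since (n − 1)! + (n − 2)! = n (n − 2)!.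
γ-normalisation : ∀ r → (ℤ.+ suc r ℚ./ (suc (suc r) !)) {{suc (suc r) ℕ.!≢0}} * (fromℕ (suc r !) + fromℕ (r !)) ≡ 1ℚ
γ-normalisation r = begin
  c * X                         ≡⟨ *-identityˡ (c * X) ⟨
  1ℚ * (c * X)                  ≡⟨ cong (_* (c * X)) (1/suc-inverseˡ r) ⟨
  (1/suc r * fromℕ A) * (c * X) ≡⟨ regroup (1/suc r) (fromℕ A) c X ⟩
  1/suc r * (c * (fromℕ A * X)) ≡⟨ cong (λ w → 1/suc r * (c * w)) A*X≡n! ⟩
  1/suc r * (c * fromℕ (n !))   ≡⟨ cong (1/suc r *_) (/-*-cancel A (n !) {{n ℕ.!≢0}}) ⟩
  1/suc r * fromℕ A             ≡⟨ 1/suc-inverseˡ r ⟩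
  1ℚ                            ∎
  where
  open ≡-Reasoning
  A = suc r
  n = suc A
  f = r !
  c = (ℤ.+ A ℚ./ (n !)) {{n ℕ.!≢0}}
  X = fromℕ (A !) + fromℕ f
  regroup : ∀ i a c x → (i * a) * (c * x) ≡ i * (c * (a * x))
  regroup = solve-∀ ℚ-ring
  A*X≡n! : fromℕ A * X ≡ fromℕ (n !)
  A*X≡n! = begin
    fromℕ A * (fromℕ (A ℕ.* f) + fromℕ f) ≡⟨ cong (fromℕ A *_) (fromℕ-+ (A ℕ.* f) f) ⟨
    fromℕ A * fromℕ (A ℕ.* f ℕ.+ f)       ≡⟨ cong (λ w → fromℕ A * fromℕ w) (ℕ.+-comm (A ℕ.* f) f) ⟩
    fromℕ A * fromℕ (n ℕ.* f)             ≡⟨ fromℕ-* A (n ℕ.* f) ⟨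
    fromℕ (A ℕ.* (n ℕ.* f))               ≡⟨ cong fromℕ (trans (sym (ℕ.*-assoc A n f)) (trans (cong (ℕ._* f) (ℕ.*-comm A n)) (ℕ.*-assoc n A f))) ⟩
    fromℕ (n ℕ.* (A ℕ.* f))               ∎

sem-sumP : ∀ {n} (ps : List (Poly n)) ρ → ⟦ sumP ps ⟧ ρ ≡ sumℚ (map (λ p → ⟦ p ⟧ ρ) ps)
sem-sumP []       ρ = refl
sem-sumP (p ∷ ps) ρ = cong (⟦ p ⟧ ρ +_) (sem-sumP ps ρ)

sem-[]act : ∀ {n} (U : List (Fin n)) Y ρ → ⟦ [ U ]act Y ⟧ ρ ≡ sumℚ (map (λ π → ⟦ Y ⟧ (ρ ∘ fromArr U π)) (arrangements U))
sem-[]act U Y ρ = trans (sem-sumP (map (λ σ → act σ Y) (S U)) ρ)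
  (cong sumℚ (trans (sym (map-∘ (map (fromArr U) (arrangements U))))
             (trans (sym (map-∘ (arrangements U))) (map-cong (λ π → sem-act (fromArr U π) Y ρ) (arrangements U)))))

sem-[c]act : ∀ {n} (c : Fin n) Y ρ → ⟦ [ c ∷ [] ]act Y ⟧ ρ ≡ ⟦ Y ⟧ ρ
sem-[c]act c Y ρ =
  trans (+-identityʳ _) (trans (sem-act (fromArr (c ∷ []) (c ∷ [])) Y ρ) (sem-ext Y (cong ρ ∘ fromArr-[c] c)))

sem-[c]′act : ∀ {n} (c : Fin n) Y ρ → ⟦ [ c ∷ [] ]'act Y ⟧ ρ ≡ ⟦ Y ⟧ ρ
sem-[c]′act c Y ρ = trans (+-identityʳ _)
  (trans (cong₂ _*_ (sgn-id (fromArr (c ∷ []) (c ∷ [])) (fromArr-[c] c)) (sem-act (fromArr (c ∷ []) (c ∷ [])) Y ρ))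
         (trans (*-identityˡ _) (sem-ext Y (cong ρ ∘ fromArr-[c] c))))

sem-singleton-columns : ∀ {n} (as : List (Fin n)) Y ρ → ⟦ foldr [_]'act Y (map (_∷ []) as) ⟧ ρ ≡ ⟦ Y ⟧ ρ
sem-singleton-columns []       Y ρ = refl
sem-singleton-columns (b ∷ as) Y ρ = trans (sem-[c]′act b (foldr [_]'act Y (map (_∷ []) as)) ρ) (sem-singleton-columns as Y ρ)

IsStandard⇒first≡0 : ∀ {n} {a₀ : Fin (suc n)} {as j} → IsStandard (tab (a₀ ∷ as) j) → a₀ ≡ Fin.zero
IsStandard⇒first≡0 {n} {a₀} {as} {j} std = locate (↭.∈-resp-↭ (↭-sym (IsStandard.bijective std)) (∈-allFin Fin.zero))
  where
  a₀<as : All (a₀ Fin.<_) as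
  a₀<as = AllPairs.head (Linked.Linked⇒AllPairs Fin.<-trans (IsStandard.rowIncr std))
  locate : Fin.zero ∈ (j ∷ a₀ ∷ as) → a₀ ≡ Fin.zero
  locate (here 0≡j)            = ⊥-elim (ℕ.n≮0 (subst (a₀ Fin.<_) (sym 0≡j) (IsStandard.colIncr′ std)))
  locate (there (here 0≡a₀))   = sym 0≡a₀
  locate (there (there 0∈as)) = ⊥-elim (ℕ.n≮0 (All.lookup a₀<as 0∈as))

-- T has rows (1, as…) and (j). The theorem takes h ρ x = Φ(ρ x), but only the equivariance h-∘ is needed.
module _ {r : ℕ} (as : List (Fin (suc (suc r)))) (j′ : Fin (suc r))
  (std : IsStandard (tab (Fin.zero ∷ as) (Fin.suc j′)))
  (h : (Fin (suc (suc r)) → ℚ) → Fin (suc (suc r)) → ℚ)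
  (h-∘ : ∀ ρ {σ} → IsPermutation σ → ∀ x → h (ρ ∘ σ) x ≡ h ρ (σ x))
  (P : Poly (suc (suc r))) (⟦P⟧ : ∀ ρ → ⟦ P ⟧ ρ ≡ h ρ (Fin.suc j′) - h ρ Fin.zero) where

  private
    N = suc (suc r)
    z j : Fin N
    z = Fin.zero
    j = Fin.suc j′
    U = z ∷ as
    T = tab U j

    !j∷U : Unique (j ∷ U)
    !j∷U = ↭allFin⇒Unique (IsStandard.bijective std)

    j∉U : All (λ u → ¬ j ≡ u) U
    j∉U = AllPairs.head !j∷U

    z∉as : All (λ u → ¬ z ≡ u) as
    z∉as = AllPairs.head (AllPairs.tail !j∷U)

    fromArr-IsPermutation : ∀ π → π ↭ U → IsPermutation (fromArr U π)
    fromArr-IsPermutation π π↭U = ↭-trans (↭.map⁺ σ (↭-sym (IsStandard.bijective std)))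
      (subst (λ w → (σ j ∷ w) ↭ allFin N) (sym (map-fromArr U π (AllPairs.tail !j∷U) (↭.↭-length π↭U)))
      (subst (λ w → (w ∷ π) ↭ allFin N) (sym (fromArr-∉ U π j j∉U)) (↭-trans (↭-prep j π↭U) (IsStandard.bijective std))))
      where σ = fromArr U π

    arrangement-term : ∀ ρ π → π ↭ U → ⟦ [ j ∷ [] ]act P ⟧ (ρ ∘ fromArr U π) ≡ h ρ j - h ρ (headOr z π)
    arrangement-term ρ []       π↭U with () ← ↭.↭-empty-inv (↭-sym π↭U)
    arrangement-term ρ (v ∷ vs) π↭U = begin
      ⟦ [ j ∷ [] ]act P ⟧ (ρ ∘ σ)    ≡⟨ trans (sem-[c]act j P (ρ ∘ σ)) (⟦P⟧ (ρ ∘ σ)) ⟩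
      h (ρ ∘ σ) j - h (ρ ∘ σ) z      ≡⟨ cong₂ _-_ (h-∘ ρ σ-perm j) (h-∘ ρ σ-perm z) ⟩
      h ρ (σ j) - h ρ (σ z)          ≡⟨ cong₂ (λ x y → h ρ x - h ρ y) (fromArr-∉ U (v ∷ vs) j j∉U) (fromArr-head z as v vs) ⟩
      h ρ j - h ρ v                  ∎
      where
      open ≡-Reasoning
      σ = fromArr U (v ∷ vs)
      σ-perm = fromArr-IsPermutation (v ∷ vs) π↭U

  row-symmetrised : ∀ ρ → ⟦ P-act T P ⟧ ρ ≡ fromℕ (suc (length as) !) * h ρ j - fromℕ (length as !) * sumℚ (map (h ρ) U)
  row-symmetrised ρ = begin
    ⟦ P-act T P ⟧ ρ
      ≡⟨ sem-[]act U ([ j ∷ [] ]act P) ρ ⟩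
    sumℚ (map (λ π → ⟦ [ j ∷ [] ]act P ⟧ (ρ ∘ fromArr U π)) (arrangements U))
      ≡⟨ sumℚ-cong (arrangements U) (All.map (λ {π} → arrangement-term ρ π) (arrangements-↭ U)) ⟩
    sumℚ (map (λ π → h ρ j - h ρ (headOr z π)) (arrangements U))
      ≡⟨ sumℚ-- (λ _ → h ρ j) (h ρ ∘ headOr z) (arrangements U) ⟩
    sumℚ (map (λ _ → h ρ j) (arrangements U)) - sumℚ (map (h ρ ∘ headOr z) (arrangements U))
      ≡⟨ cong₂ _-_ (sumℚ-arrangements-const U (h ρ j)) (sumℚ-arrangements-head (h ρ) z as) ⟩
    fromℕ (suc (length as) !) * h ρ j - fromℕ (length as !) * sumℚ (map (h ρ) U)
      ∎
    where open ≡-Reasoning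

  private
    swap : Perm N
    swap = fromArr (z ∷ j ∷ []) (j ∷ z ∷ [])

    swap-z : swap z ≡ j
    swap-z = fromArr-head z (j ∷ []) j (z ∷ [])

    swap-j : swap j ≡ z
    swap-j = trans (fromArr-skip z (j ∷ []) j (z ∷ []) j (λ ())) (fromArr-head j [] z [])

    swap-other : ∀ x → ¬ x ≡ z → ¬ x ≡ j → swap x ≡ x
    swap-other x x≢z x≢j = fromArr-∉ (z ∷ j ∷ []) (j ∷ z ∷ []) x (x≢z ∷ x≢j ∷ [])

    swap≗transp : ∀ x → swap x ≡ transp z j x
    swap≗transp x = by-cases (x ≟ z) (x ≟ j)
      where
      by-cases : Dec (x ≡ z) → Dec (x ≡ j) → swap x ≡ transp z j x
      by-cases (yes refl) _          = trans swap-z (sym (transp-left z j))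
      by-cases (no _)     (yes refl) = trans swap-j (sym (transp-right z j))
      by-cases (no x≢z)   (no x≢j)   = trans (swap-other x x≢z x≢j) (sym (transp-other z j x x≢z x≢j))

    swap-IsPermutation : IsPermutation swap
    swap-IsPermutation = subst (_↭ allFin N) (sym (map-cong swap≗transp (allFin N))) (transp-IsPermutation z j)

    unchanged : Perm N
    unchanged = fromArr (z ∷ j ∷ []) (z ∷ j ∷ [])

    unchanged≗id : ∀ x → unchanged x ≡ x
    unchanged≗id x with x ≟ z
    ... | yes x≡z = sym x≡z
    ... | no _    = fromArr-[c] j x

  column-antisymmetrised : ∀ X ρ → ⟦ N-act T X ⟧ ρ ≡ ⟦ X ⟧ ρ - ⟦ X ⟧ (ρ ∘ swap)
  column-antisymmetrised X ρ = begin
    sgn unchanged * ⟦ act unchanged Y ⟧ ρ + (sgn swap * ⟦ act swap Y ⟧ ρ + 0ℚ)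
      ≡⟨ cong₂ (λ u v → u + (v + 0ℚ))
               (cong₂ _*_ (sgn-id unchanged unchanged≗id) (trans (sem-act unchanged Y ρ) (sem-ext Y (cong ρ ∘ unchanged≗id))))
               (cong₂ _*_ (sgn-transposition₀ j′ swap swap-z swap-j (λ x x≢j′ → swap-other (Fin.suc x) (λ ()) (x≢j′ ∘ Fin.suc-injective)))
                          (sem-act swap Y ρ)) ⟩
    1ℚ * ⟦ Y ⟧ ρ + ((- 1ℚ) * ⟦ Y ⟧ (ρ ∘ swap) + 0ℚ)
      ≡⟨ signs (⟦ Y ⟧ ρ) (⟦ Y ⟧ (ρ ∘ swap)) ⟩
    ⟦ Y ⟧ ρ - ⟦ Y ⟧ (ρ ∘ swap)
      ≡⟨ cong₂ _-_ (sem-singleton-columns as X ρ) (sem-singleton-columns as X (ρ ∘ swap)) ⟩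
    ⟦ X ⟧ ρ - ⟦ X ⟧ (ρ ∘ swap)
      ∎
    where
    open ≡-Reasoning
    Y = foldr [_]'act X (map (_∷ []) as)
    signs : ∀ u v → 1ℚ * u + ((- 1ℚ) * v + 0ℚ) ≡ u - v
    signs = solve-∀ ℚ-ring

  row-symmetrised-swapped : ∀ ρ → ⟦ P-act T P ⟧ (ρ ∘ swap)
    ≡ fromℕ (suc (length as) !) * h ρ z - fromℕ (length as !) * (h ρ j + sumℚ (map (h ρ) as))
  row-symmetrised-swapped ρ = trans (row-symmetrised (ρ ∘ swap))
    (cong₂ (λ u v → fromℕ (suc (length as) !) * u - fromℕ (length as !) * v)
           (trans (h-swap j) (cong (h ρ) swap-j))
           (cong₂ _+_ (trans (h-swap z) (cong (h ρ) swap-z))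
                      (sumℚ-cong as (All.map (λ {x} (z≢x , j≢x) → trans (h-swap x) (cong (h ρ) (swap-other x (z≢x ∘ sym) (j≢x ∘ sym))))
                                             (All.zip (z∉as , All.tail j∉U))))))
    where
    h-swap : ∀ x → h (ρ ∘ swap) x ≡ h ρ (swap x)
    h-swap = h-∘ ρ swap-IsPermutation

  γ-act-fixes : ∀ ρ → ⟦ P ⟧ ρ ≡ ⟦ γ-act T P ⟧ ρ
  γ-act-fixes ρ = sym (begin
    c * ⟦ N-act T (P-act T P) ⟧ ρ
      ≡⟨ cong (c *_) (column-antisymmetrised (P-act T P) ρ) ⟩
    c * (⟦ P-act T P ⟧ ρ - ⟦ P-act T P ⟧ (ρ ∘ swap))
      ≡⟨ cong (c *_) (cong₂ _-_ (row-symmetrised ρ) (row-symmetrised-swapped ρ)) ⟩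
    c * ((F₁ * h ρ j - F₂ * (h ρ z + Σh)) - (F₁ * h ρ z - F₂ * (h ρ j + Σh)))
      ≡⟨ collect c F₁ F₂ (h ρ j) (h ρ z) Σh ⟩
    (c * (F₁ + F₂)) * (h ρ j - h ρ z)
      ≡⟨ cong (_* (h ρ j - h ρ z)) (trans (cong (λ l → c * (fromℕ (suc l !) + fromℕ (l !))) length-as) (γ-normalisation r)) ⟩
    1ℚ * (h ρ j - h ρ z)
      ≡⟨ *-identityˡ _ ⟩
    h ρ j - h ρ z
      ≡⟨ ⟦P⟧ ρ ⟨
    ⟦ P ⟧ ρ
      ∎)
    where
    open ≡-Reasoning
    c  = (ℤ.+ (N ∸ 1) ℚ./ (N !)) {{N ℕ.!≢0}}
    F₁ = fromℕ (suc (length as) !)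
    F₂ = fromℕ (length as !)
    Σh = sumℚ (map (h ρ) as)
    length-as : length as ≡ r
    length-as = ℕ.suc-injective (IsStandard.shape std)
    collect : ∀ c N M a b s → c * ((N * a - M * (b + s)) - (N * b - M * (a + s))) ≡ (c * (N + M)) * (a - b)
    collect = solve-∀ ℚ-ring

proposition5p5 : (n : ℕ) (h : 2 ≤ n) (T : Tableau n) → IsStandard T →
    (k m : ℕ) → Q h T k m ∈γQI (T , m)
proposition5p5 (suc (suc r)) (s≤s (s≤s z≤n)) (tab []        j)           std k m = ⊥-elim (IsStandard.colIncr′ std)
proposition5p5 (suc (suc r)) (s≤s (s≤s z≤n)) (tab (a₀ ∷ as) Fin.zero)    std k m = ⊥-elim (ℕ.n≮0 (IsStandard.colIncr′ std))
proposition5p5 (suc (suc r)) (s≤s (s≤s z≤n)) (tab (a₀ ∷ as) (Fin.suc j′)) std k m = first-entry-1 (IsStandard⇒first≡0 std) std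
  where
  first-entry-1 : ∀ {a₀} → a₀ ≡ Fin.zero → (std : IsStandard (tab (a₀ ∷ as) (Fin.suc j′))) →
                  Q (s≤s (s≤s z≤n)) (tab (a₀ ∷ as) (Fin.suc j′)) k m ∈γQI (tab (a₀ ∷ as) (Fin.suc j′) , m)
  first-entry-1 refl std =
      Q₀ , Φ-difference-quasiInvariant k m Fin.zero (Fin.suc j′) Q₀ ⟦Q₀⟧
         , γ-act-fixes as j′ std (λ ρ x → Φ ρ k m (ρ x)) (λ ρ {σ} σ-perm x → Φ-∘ ρ k m σ-perm (ρ (σ x))) Q₀ ⟦Q₀⟧
    where
    Q₀ = Q (s≤s (s≤s z≤n)) (tab (Fin.zero ∷ as) (Fin.suc j′)) k m
    ⟦Q₀⟧ = sem-Q (s≤s (s≤s z≤n)) (tab (Fin.zero ∷ as) (Fin.suc j′)) k m
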